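{- Let $\Gamma$ be a local type environment and $\mathcal{M},\mathcal{M}'$ multiparty sessions. If $\Gamma\vdash\mathcal{M}$ and $\mathcal{M}\xrightarrow{(\mathtt{p},\mathtt{q})\ell}\mathcal{M}'$, then there exists a local type environment $\Gamma'$ such that $\Gamma\xrightarrow{(\mathtt{p},\mathtt{q})\ell}\Gamma'$ and $\Gamma'\vdash\mathcal{M}'$.
   Context: PROCESSES. Processes: $P ::= \mathtt{p}!\ell(e).P \mid \sum_{i\in I}\mathtt{p}?\ell_i(x_i).P_i \mid \mathtt{if}\ e\ \mathtt{then}\ P\ \mathtt{else}\ P \mid \mu X.P \mid X \mid \mathbf{0}$, with $I$ finite nonempty, recursion guarded; expressions $e$ are variables, values (booleans, integers, naturals) or built with operators such as $\mathtt{succ}$, $\mathtt{neg}$, $\neg$ and nondeterministic choice; $e\downarrow v$ is standard evaluation. Sessions: $\mathcal{M} ::= \mathtt{p}\triangleleft P \mid \mathcal{M}\mid\mathcal{M} \mid \mathcal{O}$; $\prod_{i\in I}\mathtt{p}_i\triangleleft P_i$ is parallel composition. Structural congruence $\equiv$ is the least congruence with $\mathcal{M}\mid\mathcal{N}\equiv\mathcal{N}\mid\mathcal{M}$, $(\mathcal{L}\mid\mathcal{M})\mid\mathcal{N}\equiv\mathcal{L}\mid(\mathcal{M}\mid\mathcal{N})$, $\mathcal{M}\mid\mathcal{O}\equiv\mathcal{M}$. Unfolding $\Rrightarrow$ is the least relation with: $\mathcal{M}\equiv\mathcal{N}\Rightarrow\mathcal{M}\Rrightarrow\mathcal{N}$;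 transitivity; $\mathtt{p}\triangleleft\mu X.P\mid\mathcal{N}\Rrightarrow\mathtt{p}\triangleleft P[\mu X.P/X]\mid\mathcal{N}$; $e\downarrow\mathtt{true}\Rightarrow \mathtt{p}\triangleleft\mathtt{if}\ e\ \mathtt{then}\ P\ \mathtt{else}\ Q\mid\mathcal{N}\Rrightarrow\mathtt{p}\triangleleft P\mid\mathcal{N}$; $e\downarrow\mathtt{false}\Rightarrow \mathtt{p}\triangleleft\mathtt{if}\ e\ \mathtt{then}\ P\ \mathtt{else}\ Q\mid\mathcal{N}\Rrightarrow\mathtt{p}\triangleleft Q\mid\mathcal{N}$. Labelled reduction is the least relation with: (R-comm) if $j\in I$ and $e\downarrow v$ then $\mathtt{q}\triangleleft\sum_{i\in I}\mathtt{p}?\ell_i(x_i).P_i\mid\mathtt{p}\triangleleft\mathtt{q}!\ell_j(e).Q\mid\mathcal{N}\xrightarrow{(\mathtt{p},\mathtt{q})\ell_j}\mathtt{q}\triangleleft P_j[v/x_j]\mid\mathtt{p}\triangleleft Q\mid\mathcal{N}$ (the first participant of the label is the sender); (R-unfold) if $\mathcal{M}\Rrightarrow\mathcal{M}'$, $\mathcal{M}'\xrightarrow{\lambda}\mathcal{N}'$ and $\mathcal{N}'\Rrightarrow\mathcal{N}$ then $\mathcal{M}\xrightarrow{\lambda}\mathcal{N}$. TYPES. Sorts $\mathtt{int},\mathtt{bool},\mathtt{nat}$, subsorting $\le$ least reflexive with $\mathtt{nat}\le\mathtt{int}$. Local types coinductively: $T ::= \mathtt{end}\mid\mathtt{p}\&\{\ell_i(S_i).T_i\}_{i\in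 I}\mid\mathtt{p}\oplus\{\ell_i(S_i).T_i\}_{i\in I}$. Subtyping $\le$: largest relation with $\mathtt{end}\le\mathtt{end}$; $\mathtt{p}\&\{\ell_i(S_i).T_i\}_{i\in I\cup J}\le\mathtt{p}\&\{\ell_i(S'_i).T'_i\}_{i\in I}$ if $S'_i\le S_i$, $T_i\le T'_i$ for $i\in I$; $\mathtt{p}\oplus\{\ell_i(S_i).T_i\}_{i\in I}\le\mathtt{p}\oplus\{\ell_i(S'_i).T'_i\}_{i\in I\cup J}$ if $S_i\le S'_i$, $T_i\le T'_i$ for $i\in I$. Global types coinductively: $\mathbb{G}::=\mathtt{end}\mid\mathtt{p}\to\mathtt{q}:\{\ell_i(S_i).\mathbb{G}_i\}_{i\in I}$; $\mathrm{pt}(\mathbb{G})$ least solution of $\mathrm{pt}(\mathtt{end})=\emptyset$, $\mathrm{pt}(\mathtt{p}\to\mathtt{q}:\{\ell_i(S_i).\mathbb{G}_i\})=\{\mathtt{p},\mathtt{q}\}\cup\bigcup_i\mathrm{pt}(\mathbb{G}_i)$. Projection $\mathbb{G}\upharpoonright\mathtt{r}$ is the (functional) largest relation such that: $\mathtt{r}\notin\mathrm{pt}(\mathbb{G})$ gives $\mathtt{end}$; $\mathtt{p}\to\mathtt{r}:\{\ell_i(S_i).\mathbb{G}_i\}$ gives $\mathtt{p}\&\{\ell_i(S_i).T_i\}$ with $\mathbb{G}_i\upharpoonright\mathtt{r}=T_i$; $\mathtt{r}\to\mathtt{q}:\{\ell_i(S_i).\mathbb{G}_i\}$ gives $\mathtt{q}\oplus\{\ell_i(S_i).T_i\}$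 with $\mathbb{G}_i\upharpoonright\mathtt{r}=T_i$; $\mathtt{p}\to\mathtt{q}:\{\ell_i(S_i).\mathbb{G}_i\}$ with $\mathtt{r}\notin\{\mathtt{p},\mathtt{q}\}$ gives $T$ with $\mathbb{G}_i\upharpoonright\mathtt{r}=T$ for all $i$. $\mathbb{G}$ is balanced if for every subtree $\mathbb{G}'$ there is $k$ such that every $\mathtt{p}\in\mathrm{pt}(\mathbb{G}')$ occurs on every path from the root of $\mathbb{G}'$ of length $\ge k$ or ending in $\mathtt{end}$. A local type environment $\Gamma$ is a finite map from participants to local types; $\Gamma_1,\Gamma_2$ is disjoint union. $\Gamma\sqsubseteq\mathbb{G}$ (association) iff for all $\mathtt{p}\in\mathrm{pt}(\mathbb{G})$, $\mathtt{p}\in\mathrm{dom}(\Gamma)$ and $\Gamma(\mathtt{p})\le\mathbb{G}\upharpoonright\mathtt{p}$, and for all $\mathtt{p}\notin\mathrm{pt}(\mathbb{G})$, $\mathtt{p}\notin\mathrm{dom}(\Gamma)$ or $\Gamma(\mathtt{p})=\mathtt{end}$. Environment transitions are the least relation with: $\mathtt{p}:\mathtt{q}\&\{\ell_i(S_i).T_i\}_{i\in I}\xrightarrow{\mathtt{p}:\mathtt{q}\&\ell_k(S_k)}\mathtt{p}:T_k$ and $\mathtt{p}:\mathtt{q}\oplus\{\ell_i(S_i).T_i\}_{i\in I}\xrightarrow{\mathtt{p}:\mathtt{q}\oplus\ell_k(S_k)}\mathtt{p}:T_k$ ($k\in I$); $\Gamma\xrightarrow{\alpha}\Gamma'\Rightarrow\Gamma,\mathtt{p}:T\xrightarrow{\alpha}\Gamma',\mathtt{p}:T$;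 $\Gamma_1\xrightarrow{\mathtt{p}:\mathtt{q}\oplus\ell(S)}\Gamma_1'$, $\Gamma_2\xrightarrow{\mathtt{q}:\mathtt{p}\&\ell(S')}\Gamma_2'$, $S\le S'$ $\Rightarrow$ $\Gamma_1,\Gamma_2\xrightarrow{(\mathtt{p},\mathtt{q})\ell}\Gamma_1',\Gamma_2'$. TYPING. $\Theta\vdash P:T$ is the least relation with (expression typing $\Theta\vdash e:S$ standard): $\Theta\vdash\mathbf{0}:\mathtt{end}$; $\Theta,X:T\vdash X:T$; $\Theta,X:T\vdash P:T\Rightarrow\Theta\vdash\mu X.P:T$; $\Theta\vdash e:\mathtt{bool}$, $\Theta\vdash P_1:T$, $\Theta\vdash P_2:T\Rightarrow\Theta\vdash\mathtt{if}\ e\ \mathtt{then}\ P_1\ \mathtt{else}\ P_2:T$; $\Theta\vdash P:T$, $T\le T'\Rightarrow\Theta\vdash P:T'$; $\forall i\in I.\ \Theta,x_i:S_i\vdash P_i:T_i\Rightarrow\Theta\vdash\sum_{i\in I}\mathtt{p}?\ell_i(x_i).P_i:\mathtt{p}\&\{\ell_i(S_i).T_i\}_{i\in I}$; $\Theta\vdash e:S$, $\Theta\vdash P:T\Rightarrow\Theta\vdash\mathtt{p}!\ell(e).P:\mathtt{p}\oplus\{\ell(S).T\}$. Session typing: $\Gamma\vdash\prod_{i\in I}\mathtt{p}_i\triangleleft P_i$ iff for all $i\in I$, $\emptyset\vdash P_i:\Gamma(\mathtt{p}_i)$, and $\Gamma\sqsubseteq\mathbb{G}$ for some balanced, well-formed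 global type $\mathbb{G}$ projectable onto every participant. -}

module Defs where

open import Data.Nat using (ℕ; zero; suc; _≤_; _≟_)
open import Data.Integer as ℤ using (ℤ; +_)
open import Data.Bool using (Bool; true; false; if_then_else_; not)
open import Data.Fin using (Fin; toℕ)
open import Data.List using (List; []; _∷_; _++_; length; map)
open import Data.List.Membership.Propositional using (_∈_)
open import Data.List.Relation.Unary.Unique.Propositional using (Unique)
open import Data.Maybe using (Maybe; just; nothing)
open import Data.Product using (Σ; _×_; _,_; proj₁)
open import Data.Sum using (_⊎_)
open import Data.Unit using (⊤)
open import Relation.Nullary using (¬_; yes; no)
open import Relation.Binary.PropositionalEquality using (_≡_; _≢_)

Participant : Set
Participant = ℕ

Label : Set
Label = ℕ

Var : Set
Var = ℕ

PVar : Set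
PVar = ℕ

data Sort : Set where
  int bool nat : Sort

data _≤s_ : Sort → Sort → Set where
  ≤s-refl : ∀ {S} → S ≤s S
  nat≤int : nat ≤s int

-- naturals are the non-negative integers
data Value : Set where
  vbool : Bool → Value
  vint  : ℤ → Value

data Expr : Set where
  var  : Var → Expr
  val  : Value → Expr
  succ : Expr → Expr
  neg  : Expr → Expr
  ¬ₑ   : Expr → Expr
  _⊕ₑ_ : Expr → Expr → Expr     -- nondeterministic choice

data _↓_ : Expr → Value → Set where
  ↓-val  : ∀ {v} → val v ↓ v
  ↓-succ : ∀ {e z} → e ↓ vint z → succ e ↓ vint (z ℤ.+ + 1)
  ↓-neg  : ∀ {e z} → e ↓ vint z → neg e ↓ vint (ℤ.- z)
  ↓-not  : ∀ {e b} → e ↓ vbool b → ¬ₑ e ↓ vbool (not b)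
  ↓-⊕l   : ∀ {e₁ e₂ v} → e₁ ↓ v → (e₁ ⊕ₑ e₂) ↓ v
  ↓-⊕r   : ∀ {e₁ e₂ v} → e₂ ↓ v → (e₁ ⊕ₑ e₂) ↓ v

data Proc : Set where
  send : Participant → Label → Expr → Proc → Proc
  recv : Participant → (n : ℕ) → (Fin (suc n) → Label)
         → (Fin (suc n) → Var) → (Fin (suc n) → Proc) → Proc      -- Σ_{i∈I} p?ℓᵢ(xᵢ).Pᵢ , I = Fin (suc n)
  ite  : Expr → Proc → Proc → Proc
  mu   : PVar → Proc → Proc
  pvar : PVar → Proc
  nil  : Proc

GuardedIn : PVar → Proc → Set
GuardedIn X (send _ _ _ _) = ⊤
GuardedIn X (recv _ _ _ _ _) = ⊤
GuardedIn X (ite _ P Q) = GuardedIn X P × GuardedIn X Q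
GuardedIn X (mu Y P) = (Y ≡ X) ⊎ GuardedIn X P
GuardedIn X (pvar Y) = Y ≢ X
GuardedIn X nil = ⊤

data GuardedProc : Proc → Set where
  g-send : ∀ {p ℓ e P} → GuardedProc P → GuardedProc (send p ℓ e P)
  g-recv : ∀ {p n ls xs Ps} → (∀ i → GuardedProc (Ps i)) → GuardedProc (recv p n ls xs Ps)
  g-ite  : ∀ {e P Q} → GuardedProc P → GuardedProc Q → GuardedProc (ite e P Q)
  g-mu   : ∀ {X P} → GuardedIn X P → GuardedProc P → GuardedProc (mu X P)
  g-var  : ∀ {X} → GuardedProc (pvar X)
  g-nil  : GuardedProc nil

_==_ : ℕ → ℕ → Bool
m == n with m ≟ n
... | yes _ = true
... | no _ = false

substE : Expr → Value → Var → Expr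
substE (var y) v x = if y == x then val v else var y
substE (val w) v x = val w
substE (succ e) v x = succ (substE e v x)
substE (neg e) v x = neg (substE e v x)
substE (¬ₑ e) v x = ¬ₑ (substE e v x)
substE (e₁ ⊕ₑ e₂) v x = substE e₁ v x ⊕ₑ substE e₂ v x

substV : Proc → Value → Var → Proc
substV (send p ℓ e P) v x = send p ℓ (substE e v x) (substV P v x)
substV (recv p n ls xs Ps) v x =
  recv p n ls xs (λ i → if xs i == x then Ps i else substV (Ps i) v x)
substV (ite e P Q) v x = ite (substE e v x) (substV P v x) (substV Q v x)
substV (mu X P) v x = mu X (substV P v x)
substV (pvar X) v x = pvar X
substV nil v x = nil

substP : Proc → Proc → PVar → Proc
substP (send p ℓ e P) Q X = send p ℓ e (substP P Q X)
substP (recv p n ls xs Ps) Q X = recv p n ls xs (λ i → substP (Ps i) Q X)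
substP (ite e P₁ P₂) Q X = ite e (substP P₁ Q X) (substP P₂ Q X)
substP (mu Y P) Q X = if Y == X then mu Y P else mu Y (substP P Q X)
substP (pvar Y) Q X = if Y == X then Q else pvar Y
substP nil Q X = nil

infixr 5 _∥_
data Session : Set where
  _◁_ : Participant → Proc → Session
  _∥_ : Session → Session → Session
  𝒪   : Session

data _≡ₛ_ : Session → Session → Set where
  ≡-refl  : ∀ {M} → M ≡ₛ M
  ≡-sym   : ∀ {M N} → M ≡ₛ N → N ≡ₛ M
  ≡-trans : ∀ {L M N} → L ≡ₛ M → M ≡ₛ N → L ≡ₛ N
  ≡-par   : ∀ {M M' N N'} → M ≡ₛ M' → N ≡ₛ N' → (M ∥ N) ≡ₛ (M' ∥ N')
  ≡-comm  : ∀ {M N} → (M ∥ N) ≡ₛ (N ∥ M)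
  ≡-assoc : ∀ {L M N} → ((L ∥ M) ∥ N) ≡ₛ (L ∥ (M ∥ N))
  ≡-unit  : ∀ {M} → (M ∥ 𝒪) ≡ₛ M

data _⋙_ : Session → Session → Set where
  ⋙-≡     : ∀ {M N} → M ≡ₛ N → M ⋙ N
  ⋙-trans : ∀ {L M N} → L ⋙ M → M ⋙ N → L ⋙ N
  ⋙-mu    : ∀ {p X P N} → ((p ◁ mu X P) ∥ N) ⋙ ((p ◁ substP P (mu X P) X) ∥ N)
  ⋙-true  : ∀ {p e P Q N} → e ↓ vbool true → ((p ◁ ite e P Q) ∥ N) ⋙ ((p ◁ P) ∥ N)
  ⋙-false : ∀ {p e P Q N} → e ↓ vbool false → ((p ◁ ite e P Q) ∥ N) ⋙ ((p ◁ Q) ∥ N)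

record RLabel : Set where
  constructor ⟨_,_⟩_
  field
    snd : Participant
    rcv : Participant
    lbl : Label

data _—⟨_⟩→_ : Session → RLabel → Session → Set where
  r-comm : ∀ {p q n ls xs Ps e Q N v} (j : Fin (suc n)) → e ↓ v
    → ((q ◁ recv p n ls xs Ps) ∥ (p ◁ send q (ls j) e Q) ∥ N)
      —⟨ ⟨ p , q ⟩ ls j ⟩→
      ((q ◁ substV (Ps j) v (xs j)) ∥ (p ◁ Q) ∥ N)
  r-unfold : ∀ {M M' N N' λ'} → M ⋙ M' → M' —⟨ λ' ⟩→ N' → N' ⋙ N → M —⟨ λ' ⟩→ N

-- Trees: coinductive types are represented as (possibly infinite) trees,
-- i.e. functions from positions (lists of child indices) to node heads.
-- Positions outside the tree are ignored (junk).

record Br : Set where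
  constructor mkBr
  field
    n       : ℕ
    lab     : Fin (suc n) → Label
    lab-inj : ∀ i j → lab i ≡ lab j → i ≡ j
    srt     : Fin (suc n) → Sort
open Br public

child : {A : Set} → (List ℕ → A) → ℕ → (List ℕ → A)
child t i π = t (i ∷ π)

at : {A : Set} → (List ℕ → A) → List ℕ → (List ℕ → A)
at t π ρ = t (π ++ ρ)

data LHead : Set where
  hend : LHead
  hbra : Participant → Br → LHead      -- p&{ℓᵢ(Sᵢ).Tᵢ}, Tᵢ = child T i
  hsel : Participant → Br → LHead

LTy : Set
LTy = List ℕ → LHead

data SubStep (R : LTy → LTy → Set) (T U : LTy) : Set where
  s-end : T [] ≡ hend → U [] ≡ hend → SubStep R T U
  s-bra : ∀ {p b b'} → T [] ≡ hbra p b → U [] ≡ hbra p b'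
    → (∀ (i : Fin (suc (n b'))) → Σ (Fin (suc (n b))) λ j →
         lab b j ≡ lab b' i × srt b' i ≤s srt b j × R (child T (toℕ j)) (child U (toℕ i)))
    → SubStep R T U
  s-sel : ∀ {p b b'} → T [] ≡ hsel p b → U [] ≡ hsel p b'
    → (∀ (j : Fin (suc (n b))) → Σ (Fin (suc (n b'))) λ i →
         lab b' i ≡ lab b j × srt b j ≤s srt b' i × R (child T (toℕ j)) (child U (toℕ i)))
    → SubStep R T U

-- subtyping = largest relation closed under SubStep (union of all post-fixed points)
_≤L_ : LTy → LTy → Set₁
T ≤L U = Σ (LTy → LTy → Set) λ R → (∀ T' U' → R T' U' → SubStep R T' U') × R T U

data GHead : Set where
  gend : GHead
  gcom : Participant → Participant → Br → GHead   -- p→q:{ℓᵢ(Sᵢ).Gᵢ}, Gᵢ = child G i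

GTy : Set
GTy = List ℕ → GHead

-- participants: least solution
data _∈pt_ (p : Participant) : GTy → Set where
  pt-snd : ∀ {G q b} → G [] ≡ gcom p q b → p ∈pt G
  pt-rcv : ∀ {G q b} → G [] ≡ gcom q p b → p ∈pt G
  pt-sub : ∀ {G q r b} → G [] ≡ gcom q r b → (i : Fin (suc (n b)))
    → p ∈pt child G (toℕ i) → p ∈pt G

data ProjStep (R : GTy → Participant → LTy → Set) (G : GTy) (r : Participant) (T : LTy) : Set where
  pr-end  : ¬ (r ∈pt G) → T [] ≡ hend → ProjStep R G r T
  pr-in   : ∀ {p b} → G [] ≡ gcom p r b → T [] ≡ hbra p b
    → (∀ (i : Fin (suc (n b))) → R (child G (toℕ i)) r (child T (toℕ i))) → ProjStep R G r T
  pr-out  : ∀ {q b} → G [] ≡ gcom r q b → T [] ≡ hsel q b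
    → (∀ (i : Fin (suc (n b))) → R (child G (toℕ i)) r (child T (toℕ i))) → ProjStep R G r T
  pr-skip : ∀ {p q b} → G [] ≡ gcom p q b → r ≢ p → r ≢ q → r ∈pt G
    → (∀ (i : Fin (suc (n b))) → R (child G (toℕ i)) r T) → ProjStep R G r T

Proj : GTy → Participant → LTy → Set₁
Proj G r T = Σ (GTy → Participant → LTy → Set) λ R →
  (∀ G' r' T' → R G' r' T' → ProjStep R G' r' T') × R G r T

data VPath : GTy → List ℕ → Set where
  vp-nil  : ∀ {G} → VPath G []
  vp-cons : ∀ {G p q b π} → G [] ≡ gcom p q b → (i : Fin (suc (n b)))
    → VPath (child G (toℕ i)) π → VPath G (toℕ i ∷ π)

data Occ (p : Participant) : GTy → List ℕ → Set where
  occ-here  : ∀ {G q r b i π} → G [] ≡ gcom q r b → (p ≡ q ⊎ p ≡ r) → Occ p G (i ∷ π)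
  occ-there : ∀ {G i π} → Occ p (child G i) π → Occ p G (i ∷ π)

BalancedAt : GTy → Set
BalancedAt G = Σ ℕ λ k → ∀ p → p ∈pt G → ∀ ρ → VPath G ρ
  → (k ≤ length ρ ⊎ G ρ ≡ gend) → Occ p G ρ

Balanced : GTy → Set
Balanced G = ∀ π → VPath G π → BalancedAt (at G π)

WellFormed : GTy → Set
WellFormed G = ∀ π → VPath G π → ∀ p q b → G π ≡ gcom p q b → p ≢ q

Projectable : GTy → Set₁
Projectable G = ∀ r → Σ LTy (Proj G r)

record Env : Set where
  field
    look : Participant → Maybe LTy
    supp : List Participant
    fin  : ∀ p → look p ≢ nothing → p ∈ supp
open Env public

_≔_,,_ : Env → Env → Env → Set
Γ ≔ Γ₁ ,, Γ₂ = ∀ r → (look Γ₁ r ≡ nothing × look Γ r ≡ look Γ₂ r)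
                   ⊎ (look Γ₂ r ≡ nothing × look Γ r ≡ look Γ₁ r)

Sing : Env → Participant → LTy → Set
Sing Γ p T = look Γ p ≡ just T × (∀ r → r ≢ p → look Γ r ≡ nothing)

data ELabel : Set where
  inL  : Participant → Participant → Label → Sort → ELabel
  outL : Participant → Participant → Label → Sort → ELabel
  comL : Participant → Participant → Label → ELabel

data _—[_]→_ : Env → ELabel → Env → Set₁ where
  e-in : ∀ {Γ Γ' p q T b} → Sing Γ p T → T [] ≡ hbra q b → (k : Fin (suc (n b)))
    → Sing Γ' p (child T (toℕ k)) → Γ —[ inL p q (lab b k) (srt b k) ]→ Γ'
  e-out : ∀ {Γ Γ' p q T b} → Sing Γ p T → T [] ≡ hsel q b → (k : Fin (suc (n b)))
    → Sing Γ' p (child T (toℕ k)) → Γ —[ outL p q (lab b k) (srt b k) ]→ Γ'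
  e-frame : ∀ {Γ Γ' Γ₁ Γ₁' Δ p T α} → Γ ≔ Γ₁ ,, Δ → Sing Δ p T
    → Γ₁ —[ α ]→ Γ₁' → Γ' ≔ Γ₁' ,, Δ → Γ —[ α ]→ Γ'
  e-com : ∀ {Γ Γ' Γ₁ Γ₁' Γ₂ Γ₂' p q ℓ S S'} → Γ ≔ Γ₁ ,, Γ₂
    → Γ₁ —[ outL p q ℓ S ]→ Γ₁' → Γ₂ —[ inL q p ℓ S' ]→ Γ₂' → S ≤s S'
    → Γ' ≔ Γ₁' ,, Γ₂' → Γ —[ comL p q ℓ ]→ Γ'

_⊑_ : Env → GTy → Set₁
Γ ⊑ G = (∀ p → p ∈pt G → Σ LTy λ T → look Γ p ≡ just T × Σ LTy λ U → Proj G p U × T ≤L U)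
      × (∀ p → ¬ (p ∈pt G) → look Γ p ≡ nothing ⊎ Σ LTy λ T → look Γ p ≡ just T × T [] ≡ hend)

record Ctx : Set where
  field
    evar : Var → Maybe Sort
    pvr  : PVar → Maybe LTy
open Ctx public

∅ : Ctx
∅ = record { evar = λ _ → nothing ; pvr = λ _ → nothing }

_,x_∶_ : Ctx → Var → Sort → Ctx
Θ ,x x ∶ S = record Θ { evar = λ y → if y == x then just S else evar Θ y }

_,X_∶_ : Ctx → PVar → LTy → Ctx
Θ ,X X ∶ T = record Θ { pvr = λ Y → if Y == X then just T else pvr Θ Y }

data _⊢e_∶_ : Ctx → Expr → Sort → Set where
  te-var  : ∀ {Θ x S} → evar Θ x ≡ just S → Θ ⊢e var x ∶ S
  te-bool : ∀ {Θ b} → Θ ⊢e val (vbool b) ∶ bool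
  te-nat  : ∀ {Θ m} → Θ ⊢e val (vint (+ m)) ∶ nat
  te-int  : ∀ {Θ z} → Θ ⊢e val (vint z) ∶ int
  te-succ : ∀ {Θ e} → Θ ⊢e e ∶ nat → Θ ⊢e succ e ∶ nat
  te-neg  : ∀ {Θ e} → Θ ⊢e e ∶ int → Θ ⊢e neg e ∶ int
  te-not  : ∀ {Θ e} → Θ ⊢e e ∶ bool → Θ ⊢e ¬ₑ e ∶ bool
  te-⊕    : ∀ {Θ e₁ e₂ S} → Θ ⊢e e₁ ∶ S → Θ ⊢e e₂ ∶ S → Θ ⊢e (e₁ ⊕ₑ e₂) ∶ S
  te-sub  : ∀ {Θ e S S'} → Θ ⊢e e ∶ S → S ≤s S' → Θ ⊢e e ∶ S'

single : Label → Sort → Br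
single ℓ S = mkBr 0 (λ _ → ℓ) (λ { Fin.zero Fin.zero _ → _≡_.refl }) (λ _ → S)

data _⊢_∶_ : Ctx → Proc → LTy → Set₁ where
  t-nil : ∀ {Θ T} → T [] ≡ hend → Θ ⊢ nil ∶ T
  t-var : ∀ {Θ X T} → pvr Θ X ≡ just T → Θ ⊢ pvar X ∶ T
  t-rec : ∀ {Θ X P T} → (Θ ,X X ∶ T) ⊢ P ∶ T → Θ ⊢ mu X P ∶ T
  t-if  : ∀ {Θ e P₁ P₂ T} → Θ ⊢e e ∶ bool → Θ ⊢ P₁ ∶ T → Θ ⊢ P₂ ∶ T → Θ ⊢ ite e P₁ P₂ ∶ T
  t-sub : ∀ {Θ P T T'} → Θ ⊢ P ∶ T → T ≤L T' → Θ ⊢ P ∶ T'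
  t-in  : ∀ {Θ p n ls xs Ps T} (inj : ∀ i j → ls i ≡ ls j → i ≡ j) (Ss : Fin (suc n) → Sort)
    → T [] ≡ hbra p (mkBr n ls inj Ss)
    → (∀ i → (Θ ,x xs i ∶ Ss i) ⊢ Ps i ∶ child T (toℕ i))
    → Θ ⊢ recv p n ls xs Ps ∶ T
  t-out : ∀ {Θ p ℓ e P S T} → Θ ⊢e e ∶ S → T [] ≡ hsel p (single ℓ S)
    → Θ ⊢ P ∶ child T 0 → Θ ⊢ send p ℓ e P ∶ T

comps : Session → List (Participant × Proc)
comps (p ◁ P) = (p , P) ∷ []
comps (M ∥ N) = comps M ++ comps N
comps 𝒪 = []

GuardedSession : Session → Set
GuardedSession M = ∀ {p P} → (p , P) ∈ comps M → GuardedProc P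

_⊢s_ : Env → Session → Set₁
Γ ⊢s M = Unique (map proj₁ (comps M))
       × (∀ {p P} → (p , P) ∈ comps M → Σ LTy λ T → look Γ p ≡ just T × (∅ ⊢ P ∶ T))
       × Σ GTy λ G → Balanced G × WellFormed G × Projectable G × Γ ⊑ G

module Submission where

-- In a communication (p,q)ℓ the sender's type is a selection towards q and the receiver's a branching
-- from p. Association refines both by the projections of a global type G, and subtyping carries the
-- label sent by p to a branch of G and on to a branch of the receive, with compatible sorts. Since the
-- projections onto p and q can only skip communications between other participants, G starts, below
-- such communications, with the exchange p → q. Removing that exchange at the chosen branch yields a
-- global type whose projections onto p and q are the continuations and onto everybody else are
-- unchanged; its paths are paths of G with one node removed, so it stays well-formed, and it stays
-- balanced because p occurs within bounded depth, which bounds the depth of the exchange. The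
-- environment performs the matching step by framing the singleton steps of p and q. Unfolding
-- preserves typing by the substitution lemmas.

open import Defs
open import Data.Bool using (true; false; if_then_else_)
open import Data.Empty using (⊥; ⊥-elim)
open import Data.Fin using (Fin; toℕ)
open import Data.Integer using (+_)
open import Data.List using (List; []; _∷_; _++_; length; map)
open import Data.List.Membership.Propositional using (_∈_)
open import Data.List.Relation.Binary.Permutation.Propositional using (_↭_; ↭-refl; ↭-sym; ↭-trans; ↭⇒↭ₛ)
open import Data.List.Relation.Binary.Permutation.Propositional.Properties
  using (∈-resp-↭; map⁺; ++⁺; ++-comm; ++-assoc; ++-identityʳ)
open import Data.List.Relation.Unary.Unique.Propositional using (Unique)
open import Data.List.Relation.Unary.Any using (here; there)
open import Data.List.Relation.Unary.All as All using (All; _∷_)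
open import Data.List.Relation.Unary.AllPairs using (_∷_)
open import Data.List.Membership.Propositional.Properties using (∈-map⁺)
open import Data.Maybe using (Maybe; just; nothing)
open import Data.Maybe.Properties using (just-injective)
open import Data.Nat using (ℕ; zero; suc; _≟_; _≤_; _⊔_; z≤n; s≤s)
open import Data.Nat.Properties using (≤-refl; ≤-trans; m≤m⊔n; m≤n⊔m; n≤1+n)
open import Data.Product using (Σ; _×_; _,_; proj₁; proj₂)
open import Data.Sum using (_⊎_; inj₁; inj₂; map₁; map₂) renaming (map to map-⊎)
open import Relation.Nullary using (¬_; Dec; yes; no)
open import Relation.Binary.PropositionalEquality using (_≡_; _≢_; _≗_; refl; sym; trans; subst; setoid; ≢-sym)
open import Data.List.Relation.Binary.Permutation.Setoid.Properties (setoid Participant) using (Unique-resp-↭)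

==-refl : ∀ n → (n == n) ≡ true
==-refl n with n ≟ n
... | yes _ = refl
... | no n≢n = ⊥-elim (n≢n refl)

≢⇒==-false : ∀ {m n} → m ≢ n → (m == n) ≡ false
≢⇒==-false {m} {n} m≢n with m ≟ n
... | yes m≡n = ⊥-elim (m≢n m≡n)
... | no _ = refl

==-true⇒≡ : ∀ {m n} → (m == n) ≡ true → m ≡ n
==-true⇒≡ {m} {n} eq with m ≟ n
==-true⇒≡ {m} {n} eq | yes m≡n = m≡n
==-true⇒≡ {m} {n} () | no _

==-false⇒≢ : ∀ {m n} → (m == n) ≡ false → m ≢ n
==-false⇒≢ {m} {n} eq with m ≟ n
==-false⇒≢ {m} {n} () | yes _
==-false⇒≢ {m} {n} eq | no m≢n = m≢n

≤s-trans : ∀ {S₁ S₂ S₃} → S₁ ≤s S₂ → S₂ ≤s S₃ → S₁ ≤s S₃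
≤s-trans ≤s-refl S₂≤S₃ = S₂≤S₃
≤s-trans nat≤int ≤s-refl = nat≤int

_⊆ᶜ_ : Ctx → Ctx → Set
Θ₁ ⊆ᶜ Θ₂ = (∀ x S → evar Θ₁ x ≡ just S → evar Θ₂ x ≡ just S)
          × (∀ X T → pvr Θ₁ X ≡ just T → pvr Θ₂ X ≡ just T)

∅-⊆ᶜ : ∀ Θ → ∅ ⊆ᶜ Θ
∅-⊆ᶜ Θ = (λ _ _ ()) , (λ _ _ ())

⊆ᶜ-,x : ∀ {Θ₁ Θ₂} x S → Θ₁ ⊆ᶜ Θ₂ → (Θ₁ ,x x ∶ S) ⊆ᶜ (Θ₂ ,x x ∶ S)
⊆ᶜ-,x {Θ₁} {Θ₂} x S (vars , pvars) = extended , pvars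
  where
  extended : ∀ y S′ → evar (Θ₁ ,x x ∶ S) y ≡ just S′ → evar (Θ₂ ,x x ∶ S) y ≡ just S′
  extended y S′ lookup with y == x
  ... | true = lookup
  ... | false = vars y S′ lookup

⊆ᶜ-,X : ∀ {Θ₁ Θ₂} X T → Θ₁ ⊆ᶜ Θ₂ → (Θ₁ ,X X ∶ T) ⊆ᶜ (Θ₂ ,X X ∶ T)
⊆ᶜ-,X {Θ₁} {Θ₂} X T (vars , pvars) = vars , extended
  where
  extended : ∀ Y T′ → pvr (Θ₁ ,X X ∶ T) Y ≡ just T′ → pvr (Θ₂ ,X X ∶ T) Y ≡ just T′
  extended Y T′ lookup with Y == X
  ... | true = lookup
  ... | false = pvars Y T′ lookup

⊢e-weaken : ∀ {Θ₁ Θ₂ e S} → (∀ x S → evar Θ₁ x ≡ just S → evar Θ₂ x ≡ just S)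
  → Θ₁ ⊢e e ∶ S → Θ₂ ⊢e e ∶ S
⊢e-weaken ⊆ (te-var x∶S) = te-var (⊆ _ _ x∶S)
⊢e-weaken ⊆ te-bool = te-bool
⊢e-weaken ⊆ te-nat = te-nat
⊢e-weaken ⊆ te-int = te-int
⊢e-weaken ⊆ (te-succ ⊢e) = te-succ (⊢e-weaken ⊆ ⊢e)
⊢e-weaken ⊆ (te-neg ⊢e) = te-neg (⊢e-weaken ⊆ ⊢e)
⊢e-weaken ⊆ (te-not ⊢e) = te-not (⊢e-weaken ⊆ ⊢e)
⊢e-weaken ⊆ (te-⊕ ⊢e₁ ⊢e₂) = te-⊕ (⊢e-weaken ⊆ ⊢e₁) (⊢e-weaken ⊆ ⊢e₂)
⊢e-weaken ⊆ (te-sub ⊢e S≤S′) = te-sub (⊢e-weaken ⊆ ⊢e) S≤S′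

⊢-weaken : ∀ {Θ₁ Θ₂ P T} → Θ₁ ⊆ᶜ Θ₂ → Θ₁ ⊢ P ∶ T → Θ₂ ⊢ P ∶ T
⊢-weaken ⊆ (t-nil end) = t-nil end
⊢-weaken ⊆ (t-var X∶T) = t-var (proj₂ ⊆ _ _ X∶T)
⊢-weaken ⊆ (t-rec {X = X} {T = T} ⊢P) = t-rec (⊢-weaken (⊆ᶜ-,X X T ⊆) ⊢P)
⊢-weaken ⊆ (t-if ⊢e ⊢P ⊢Q) = t-if (⊢e-weaken (proj₁ ⊆) ⊢e) (⊢-weaken ⊆ ⊢P) (⊢-weaken ⊆ ⊢Q)
⊢-weaken ⊆ (t-sub ⊢P T≤T′) = t-sub (⊢-weaken ⊆ ⊢P) T≤T′
⊢-weaken ⊆ (t-in {xs = xs} inj Ss head ⊢Ps) =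
  t-in inj Ss head (λ i → ⊢-weaken (⊆ᶜ-,x (xs i) (Ss i) ⊆) (⊢Ps i))
⊢-weaken ⊆ (t-out ⊢e head ⊢P) = t-out (⊢e-weaken (proj₁ ⊆) ⊢e) head (⊢-weaken ⊆ ⊢P)

⊢e-val-ctx : ∀ {Θ Θ′ v S} → Θ ⊢e val v ∶ S → Θ′ ⊢e val v ∶ S
⊢e-val-ctx te-bool = te-bool
⊢e-val-ctx te-nat = te-nat
⊢e-val-ctx te-int = te-int
⊢e-val-ctx (te-sub ⊢v S≤S′) = te-sub (⊢e-val-ctx ⊢v) S≤S′

record ExtendsV (Θ′ Θ : Ctx) (x : Var) (S : Sort) : Set where
  field
    bound  : evar Θ′ x ≡ just S
    others : ∀ y S′ → y ≢ x → evar Θ′ y ≡ just S′ → evar Θ y ≡ just S′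
    pvars  : ∀ X T → pvr Θ′ X ≡ just T → pvr Θ X ≡ just T
open ExtendsV

ExtendsV-∅ : ∀ x S → ExtendsV (∅ ,x x ∶ S) ∅ x S
ExtendsV-∅ x S = record { bound = bound′ ; others = others′ ; pvars = λ _ _ () }
  where
  bound′ : evar (∅ ,x x ∶ S) x ≡ just S
  bound′ rewrite ==-refl x = refl
  others′ : ∀ y S′ → y ≢ x → evar (∅ ,x x ∶ S) y ≡ just S′ → evar ∅ y ≡ just S′
  others′ y S′ y≢x lookup rewrite ≢⇒==-false y≢x = lookup

ExtendsV-,X : ∀ {Θ′ Θ x S} X T → ExtendsV Θ′ Θ x S → ExtendsV (Θ′ ,X X ∶ T) (Θ ,X X ∶ T) x S
ExtendsV-,X {Θ′} {Θ} X T ext = record { bound = bound ext ; others = others ext ; pvars = pvars′ }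
  where
  pvars′ : ∀ Y T′ → pvr (Θ′ ,X X ∶ T) Y ≡ just T′ → pvr (Θ ,X X ∶ T) Y ≡ just T′
  pvars′ Y T′ lookup with Y == X
  ... | true = lookup
  ... | false = pvars ext Y T′ lookup

ExtendsV-,x : ∀ {Θ′ Θ x S} y S₀ → y ≢ x → ExtendsV Θ′ Θ x S → ExtendsV (Θ′ ,x y ∶ S₀) (Θ ,x y ∶ S₀) x S
ExtendsV-,x {Θ′} {Θ} {x} {S} y S₀ y≢x ext = record { bound = bound′ ; others = others′ ; pvars = pvars ext }
  where
  bound′ : evar (Θ′ ,x y ∶ S₀) x ≡ just S
  bound′ rewrite ≢⇒==-false (λ x≡y → y≢x (sym x≡y)) = bound ext
  others′ : ∀ z S′ → z ≢ x → evar (Θ′ ,x y ∶ S₀) z ≡ just S′ → evar (Θ ,x y ∶ S₀) z ≡ just S′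
  others′ z S′ z≢x lookup with z == y
  ... | true = lookup
  ... | false = others ext z S′ z≢x lookup

ExtendsV-shadow : ∀ {Θ′ Θ x S} y S₀ → y ≡ x → ExtendsV Θ′ Θ x S → (Θ′ ,x y ∶ S₀) ⊆ᶜ (Θ ,x y ∶ S₀)
ExtendsV-shadow {Θ′} {Θ} y S₀ y≡x ext = vars , pvars ext
  where
  vars : ∀ z S′ → evar (Θ′ ,x y ∶ S₀) z ≡ just S′ → evar (Θ ,x y ∶ S₀) z ≡ just S′
  vars z S′ lookup with z == y in z=y
  ... | true = lookup
  ... | false = others ext z S′ (λ z≡x → ==-false⇒≢ z=y (trans z≡x (sym y≡x))) lookup

⊢e-substE : ∀ {Θ′ Θ x S v e S′} → ExtendsV Θ′ Θ x S → Θ ⊢e val v ∶ S → Θ′ ⊢e e ∶ S′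
  → Θ ⊢e substE e v x ∶ S′
⊢e-substE {Θ′} {x = x} ext ⊢v (te-var {x = y} y∶S′) with y == x in y=x
... | true with trans (sym (subst (λ z → evar Θ′ z ≡ _) (==-true⇒≡ y=x) y∶S′)) (bound ext)
...   | refl = ⊢v
⊢e-substE ext ⊢v (te-var {x = y} y∶S′) | false = te-var (others ext y _ (==-false⇒≢ y=x) y∶S′)
⊢e-substE ext ⊢v te-bool = te-bool
⊢e-substE ext ⊢v te-nat = te-nat
⊢e-substE ext ⊢v te-int = te-int
⊢e-substE ext ⊢v (te-succ ⊢e) = te-succ (⊢e-substE ext ⊢v ⊢e)
⊢e-substE ext ⊢v (te-neg ⊢e) = te-neg (⊢e-substE ext ⊢v ⊢e)
⊢e-substE ext ⊢v (te-not ⊢e) = te-not (⊢e-substE ext ⊢v ⊢e)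
⊢e-substE ext ⊢v (te-⊕ ⊢e₁ ⊢e₂) = te-⊕ (⊢e-substE ext ⊢v ⊢e₁) (⊢e-substE ext ⊢v ⊢e₂)
⊢e-substE ext ⊢v (te-sub ⊢e S≤S′) = te-sub (⊢e-substE ext ⊢v ⊢e) S≤S′

⊢-substV : ∀ {Θ′ Θ x S v P T} → ExtendsV Θ′ Θ x S → Θ ⊢e val v ∶ S → Θ′ ⊢ P ∶ T
  → Θ ⊢ substV P v x ∶ T
⊢-substV ext ⊢v (t-nil end) = t-nil end
⊢-substV ext ⊢v (t-var X∶T) = t-var (pvars ext _ _ X∶T)
⊢-substV ext ⊢v (t-rec {X = X} {T = T} ⊢P) = t-rec (⊢-substV (ExtendsV-,X X T ext) (⊢e-val-ctx ⊢v) ⊢P)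
⊢-substV ext ⊢v (t-if ⊢e ⊢P ⊢Q) = t-if (⊢e-substE ext ⊢v ⊢e) (⊢-substV ext ⊢v ⊢P) (⊢-substV ext ⊢v ⊢Q)
⊢-substV ext ⊢v (t-sub ⊢P T≤T′) = t-sub (⊢-substV ext ⊢v ⊢P) T≤T′
⊢-substV {Θ = Θ} {x} {v = v} ext ⊢v (t-in {xs = xs} {Ps} {T} inj Ss head ⊢Ps) = t-in inj Ss head branch
  where
  branch : ∀ i → (Θ ,x xs i ∶ Ss i) ⊢ (if xs i == x then Ps i else substV (Ps i) v x) ∶ child T (toℕ i)
  branch i with xs i == x in xᵢ=x
  ... | true = ⊢-weaken (ExtendsV-shadow (xs i) (Ss i) (==-true⇒≡ xᵢ=x) ext) (⊢Ps i)
  ... | false = ⊢-substV (ExtendsV-,x (xs i) (Ss i) (==-false⇒≢ xᵢ=x) ext) (⊢e-val-ctx ⊢v) (⊢Ps i)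
⊢-substV ext ⊢v (t-out ⊢e head ⊢P) = t-out (⊢e-substE ext ⊢v ⊢e) head (⊢-substV ext ⊢v ⊢P)

record ExtendsP (Θ′ Θ : Ctx) (X : PVar) (T : LTy) : Set where
  field
    bound  : pvr Θ′ X ≡ just T
    others : ∀ Y T′ → Y ≢ X → pvr Θ′ Y ≡ just T′ → pvr Θ Y ≡ just T′
    vars   : ∀ y S → evar Θ′ y ≡ just S → evar Θ y ≡ just S
open ExtendsP

ExtendsP-∅ : ∀ X T → ExtendsP (∅ ,X X ∶ T) ∅ X T
ExtendsP-∅ X T = record { bound = bound′ ; others = others′ ; vars = λ _ _ () }
  where
  bound′ : pvr (∅ ,X X ∶ T) X ≡ just T
  bound′ rewrite ==-refl X = refl
  others′ : ∀ Y T′ → Y ≢ X → pvr (∅ ,X X ∶ T) Y ≡ just T′ → pvr ∅ Y ≡ just T′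
  others′ Y T′ Y≢X lookup rewrite ≢⇒==-false Y≢X = lookup

ExtendsP-,x : ∀ {Θ′ Θ X T} y S → ExtendsP Θ′ Θ X T → ExtendsP (Θ′ ,x y ∶ S) (Θ ,x y ∶ S) X T
ExtendsP-,x {Θ′} {Θ} y S ext = record { bound = bound ext ; others = others ext ; vars = vars′ }
  where
  vars′ : ∀ z S′ → evar (Θ′ ,x y ∶ S) z ≡ just S′ → evar (Θ ,x y ∶ S) z ≡ just S′
  vars′ z S′ lookup with z == y
  ... | true = lookup
  ... | false = vars ext z S′ lookup

ExtendsP-,X : ∀ {Θ′ Θ X T} Y T₀ → Y ≢ X → ExtendsP Θ′ Θ X T → ExtendsP (Θ′ ,X Y ∶ T₀) (Θ ,X Y ∶ T₀) X T
ExtendsP-,X {Θ′} {Θ} {X} {T} Y T₀ Y≢X ext = record { bound = bound′ ; others = others′ ; vars = vars ext }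
  where
  bound′ : pvr (Θ′ ,X Y ∶ T₀) X ≡ just T
  bound′ rewrite ≢⇒==-false (λ X≡Y → Y≢X (sym X≡Y)) = bound ext
  others′ : ∀ Z T′ → Z ≢ X → pvr (Θ′ ,X Y ∶ T₀) Z ≡ just T′ → pvr (Θ ,X Y ∶ T₀) Z ≡ just T′
  others′ Z T′ Z≢X lookup with Z == Y
  ... | true = lookup
  ... | false = others ext Z T′ Z≢X lookup

ExtendsP-shadow : ∀ {Θ′ Θ X T} Y T₀ → Y ≡ X → ExtendsP Θ′ Θ X T → (Θ′ ,X Y ∶ T₀) ⊆ᶜ (Θ ,X Y ∶ T₀)
ExtendsP-shadow {Θ′} {Θ} Y T₀ Y≡X ext = vars ext , pvars′
  where
  pvars′ : ∀ Z T′ → pvr (Θ′ ,X Y ∶ T₀) Z ≡ just T′ → pvr (Θ ,X Y ∶ T₀) Z ≡ just T′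
  pvars′ Z T′ lookup with Z == Y in Z=Y
  ... | true = lookup
  ... | false = others ext Z T′ (λ Z≡X → ==-false⇒≢ Z=Y (trans Z≡X (sym Y≡X))) lookup

⊢-substP : ∀ {Θ′ Θ X T₀ Q P T} → ExtendsP Θ′ Θ X T₀ → ∅ ⊢ Q ∶ T₀ → Θ′ ⊢ P ∶ T
  → Θ ⊢ substP P Q X ∶ T
⊢-substP ext ⊢Q (t-nil end) = t-nil end
⊢-substP {Θ′} {Θ} {X} ext ⊢Q (t-var {X = Y} Y∶T) with Y == X in Y=X
... | true with trans (sym Y∶T) (subst (λ Z → pvr Θ′ Z ≡ _) (sym (==-true⇒≡ Y=X)) (bound ext))
...   | refl = ⊢-weaken (∅-⊆ᶜ Θ) ⊢Q
⊢-substP ext ⊢Q (t-var {X = Y} Y∶T) | false = t-var (others ext Y _ (==-false⇒≢ Y=X) Y∶T)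
⊢-substP {X = X} ext ⊢Q (t-rec {X = Y} {T = T} ⊢P) with Y == X in Y=X
... | true = t-rec (⊢-weaken (ExtendsP-shadow Y T (==-true⇒≡ Y=X) ext) ⊢P)
... | false = t-rec (⊢-substP (ExtendsP-,X Y T (==-false⇒≢ Y=X) ext) ⊢Q ⊢P)
⊢-substP ext ⊢Q (t-if ⊢e ⊢P₁ ⊢P₂) = t-if (⊢e-weaken (vars ext) ⊢e) (⊢-substP ext ⊢Q ⊢P₁) (⊢-substP ext ⊢Q ⊢P₂)
⊢-substP ext ⊢Q (t-sub ⊢P T≤T′) = t-sub (⊢-substP ext ⊢Q ⊢P) T≤T′
⊢-substP ext ⊢Q (t-in {xs = xs} inj Ss head ⊢Ps) =
  t-in inj Ss head (λ i → ⊢-substP (ExtendsP-,x (xs i) (Ss i) ext) ⊢Q (⊢Ps i))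
⊢-substP ext ⊢Q (t-out ⊢e head ⊢P) = t-out (⊢e-weaken (vars ext) ⊢e) head (⊢-substP ext ⊢Q ⊢P)

bra≢end : ∀ {p b} → hbra p b ≢ hend
bra≢end ()

sel≢end : ∀ {q b} → hsel q b ≢ hend
sel≢end ()

≤L-sel-inv : ∀ {T U q b} → T ≤L U → T [] ≡ hsel q b
  → Σ Br λ b′ → U [] ≡ hsel q b′ × (∀ (j : Fin (suc (n b))) → Σ (Fin (suc (n b′))) λ i →
      lab b′ i ≡ lab b j × srt b j ≤s srt b′ i × child T (toℕ j) ≤L child U (toℕ i))
≤L-sel-inv {T} {U} (R , post , T≤U) T-sel with post T U T≤U
... | s-end T-end _ with trans (sym T-sel) T-end
...   | ()
≤L-sel-inv (R , post , T≤U) T-sel | s-bra T-bra _ _ with trans (sym T-sel) T-bra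
...   | ()
≤L-sel-inv (R , post , T≤U) T-sel | s-sel T-sel′ U-sel cover with trans (sym T-sel) T-sel′
...   | refl = _ , U-sel , λ j → let (i , ℓ≡ , S≤ , Tⱼ≤Uᵢ) = cover j in i , ℓ≡ , S≤ , (R , post , Tⱼ≤Uᵢ)

≤L-bra-inv : ∀ {T U p b} → T ≤L U → T [] ≡ hbra p b
  → Σ Br λ b′ → U [] ≡ hbra p b′ × (∀ (i : Fin (suc (n b′))) → Σ (Fin (suc (n b))) λ j →
      lab b j ≡ lab b′ i × srt b′ i ≤s srt b j × child T (toℕ j) ≤L child U (toℕ i))
≤L-bra-inv {T} {U} (R , post , T≤U) T-bra with post T U T≤U
... | s-end T-end _ with trans (sym T-bra) T-end
...   | ()
≤L-bra-inv (R , post , T≤U) T-bra | s-sel T-sel _ _ with trans (sym T-bra) T-sel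
...   | ()
≤L-bra-inv (R , post , T≤U) T-bra | s-bra T-bra′ U-bra cover with trans (sym T-bra) T-bra′
...   | refl = _ , U-bra , λ i → let (j , ℓ≡ , S≤ , Tⱼ≤Uᵢ) = cover i in j , ℓ≡ , S≤ , (R , post , Tⱼ≤Uᵢ)

≤L-end-inv : ∀ {T U} → T ≤L U → U [] ≡ hend → T [] ≡ hend
≤L-end-inv {T} {U} (R , post , T≤U) U-end with post T U T≤U
... | s-end T-end _ = T-end
... | s-bra _ U-bra _ = ⊥-elim (bra≢end (trans (sym U-bra) U-end))
... | s-sel _ U-sel _ = ⊥-elim (sel≢end (trans (sym U-sel) U-end))

record SendTyping (Θ : Ctx) (q : Participant) (ℓ : Label) (e : Expr) (Q : Proc) (T : LTy) : Set₁ where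
  constructor sendTyping
  field
    branches : Br
    head     : T [] ≡ hsel q branches
    index    : Fin (suc (n branches))
    label    : lab branches index ≡ ℓ
    sort     : Sort
    ⊢payload : Θ ⊢e e ∶ sort
    sort≤    : sort ≤s srt branches index
    ⊢cont    : Θ ⊢ Q ∶ child T (toℕ index)

⊢-send-inv : ∀ {Θ q ℓ e Q T} → Θ ⊢ send q ℓ e Q ∶ T → SendTyping Θ q ℓ e Q T
⊢-send-inv (t-out ⊢e head ⊢Q) = sendTyping _ head Fin.zero refl _ ⊢e ≤s-refl ⊢Q
⊢-send-inv (t-sub ⊢send T≤T′) with ⊢-send-inv ⊢send
... | sendTyping b head k label S ⊢e S≤ ⊢Q with ≤L-sel-inv T≤T′ head
...   | b′ , head′ , cover with cover k
...     | i , ℓ≡ , S≤′ , Tₖ≤T′ᵢ =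
  sendTyping b′ head′ i (trans ℓ≡ label) S ⊢e (≤s-trans S≤ S≤′) (t-sub ⊢Q Tₖ≤T′ᵢ)

record RecvTyping (Θ : Ctx) (p : Participant) (m : ℕ) (ls : Fin (suc m) → Label)
                  (xs : Fin (suc m) → Var) (Ps : Fin (suc m) → Proc) (T : LTy) : Set₁ where
  constructor recvTyping
  field
    branches   : Br
    head       : T [] ≡ hbra p branches
    labels-inj : ∀ i j → ls i ≡ ls j → i ≡ j
    sorts      : Fin (suc m) → Sort
    branch     : ∀ (k : Fin (suc (n branches))) → Σ (Fin (suc m)) λ j →
                   ls j ≡ lab branches k × srt branches k ≤s sorts j
                   × (Θ ,x xs j ∶ sorts j) ⊢ Ps j ∶ child T (toℕ k)

⊢-recv-inv : ∀ {Θ p m ls xs Ps T} → Θ ⊢ recv p m ls xs Ps ∶ T → RecvTyping Θ p m ls xs Ps T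
⊢-recv-inv (t-in inj Ss head ⊢Ps) = recvTyping _ head inj Ss λ k → k , refl , ≤s-refl , ⊢Ps k
⊢-recv-inv (t-sub ⊢recv T≤T′) with ⊢-recv-inv ⊢recv
... | recvTyping b head inj Ss branch with ≤L-bra-inv T≤T′ head
...   | b′ , head′ , cover = recvTyping b′ head′ inj Ss λ k →
  let (j , ℓ≡ , S≤ , Tⱼ≤T′ₖ) = cover k
      (j′ , ℓ≡′ , S≤′ , ⊢Pⱼ′) = branch j
  in j′ , trans ℓ≡′ ℓ≡ , ≤s-trans S≤ S≤′ , t-sub ⊢Pⱼ′ Tⱼ≤T′ₖ

⊢-unfold : ∀ {X P T} → ∅ ⊢ mu X P ∶ T → ∅ ⊢ substP P (mu X P) X ∶ T
⊢-unfold (t-rec {X = X} {T = T} ⊢P) = ⊢-substP (ExtendsP-∅ X T) (t-rec ⊢P) ⊢P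
⊢-unfold (t-sub ⊢mu T≤T′) = t-sub (⊢-unfold ⊢mu) T≤T′

⊢-ite-then : ∀ {Θ e P Q T} → Θ ⊢ ite e P Q ∶ T → Θ ⊢ P ∶ T
⊢-ite-then (t-if _ ⊢P _) = ⊢P
⊢-ite-then (t-sub ⊢ite T≤T′) = t-sub (⊢-ite-then ⊢ite) T≤T′

⊢-ite-else : ∀ {Θ e P Q T} → Θ ⊢ ite e P Q ∶ T → Θ ⊢ Q ∶ T
⊢-ite-else (t-if _ _ ⊢Q) = ⊢Q
⊢-ite-else (t-sub ⊢ite T≤T′) = t-sub (⊢-ite-else ⊢ite) T≤T′

nat-value-nonneg : ∀ {Θ z} → Θ ⊢e val (vint z) ∶ nat → Σ ℕ λ k → z ≡ + k
nat-value-nonneg te-nat = _ , refl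
nat-value-nonneg (te-sub ⊢z ≤s-refl) = nat-value-nonneg ⊢z

⊢e-↓ : ∀ {e v S} → ∅ ⊢e e ∶ S → e ↓ v → ∅ ⊢e val v ∶ S
⊢e-↓ te-bool ↓-val = te-bool
⊢e-↓ te-nat ↓-val = te-nat
⊢e-↓ te-int ↓-val = te-int
⊢e-↓ (te-succ ⊢e) (↓-succ e↓) with nat-value-nonneg (⊢e-↓ ⊢e e↓)
... | _ , refl = te-nat
⊢e-↓ (te-neg ⊢e) (↓-neg e↓) = te-int
⊢e-↓ (te-not ⊢e) (↓-not e↓) = te-bool
⊢e-↓ (te-⊕ ⊢e₁ ⊢e₂) (↓-⊕l e↓) = ⊢e-↓ ⊢e₁ e↓
⊢e-↓ (te-⊕ ⊢e₁ ⊢e₂) (↓-⊕r e↓) = ⊢e-↓ ⊢e₂ e↓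
⊢e-↓ (te-sub ⊢e S≤S′) e↓ = te-sub (⊢e-↓ ⊢e e↓) S≤S′

names : Session → List Participant
names M = map proj₁ (comps M)

ComponentsTyped : Env → Session → Set₁
ComponentsTyped Γ M = ∀ {p P} → (p , P) ∈ comps M → Σ LTy λ T → look Γ p ≡ just T × (∅ ⊢ P ∶ T)

comps-↭ : ∀ {M N} → M ≡ₛ N → comps M ↭ comps N
comps-↭ ≡-refl = ↭-refl
comps-↭ (≡-sym M≡N) = ↭-sym (comps-↭ M≡N)
comps-↭ (≡-trans L≡M M≡N) = ↭-trans (comps-↭ L≡M) (comps-↭ M≡N)
comps-↭ (≡-par M≡M′ N≡N′) = ++⁺ (comps-↭ M≡M′) (comps-↭ N≡N′)
comps-↭ (≡-comm {M} {N}) = ++-comm (comps M) (comps N)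
comps-↭ (≡-assoc {L} {M} {N}) = ++-assoc (comps L) (comps M) (comps N)
comps-↭ (≡-unit {M}) = ++-identityʳ (comps M)

retype-head : ∀ {Γ p P P′ N} → (∀ {T} → ∅ ⊢ P ∶ T → ∅ ⊢ P′ ∶ T)
  → ComponentsTyped Γ ((p ◁ P) ∥ N) → ComponentsTyped Γ ((p ◁ P′) ∥ N)
retype-head retype typed (here refl) = let (T , p∶T , ⊢P) = typed (here refl) in T , p∶T , retype ⊢P
retype-head retype typed (there P∈N) = typed (there P∈N)

⋙-preserves-typing : ∀ {Γ M N} → M ⋙ N → Unique (names M) → ComponentsTyped Γ M
  → Unique (names N) × ComponentsTyped Γ N
⋙-preserves-typing (⋙-≡ M≡N) unique typed =
  Unique-resp-↭ (↭⇒↭ₛ (map⁺ proj₁ (comps-↭ M≡N))) unique ,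
  λ P∈N → typed (∈-resp-↭ (↭-sym (comps-↭ M≡N)) P∈N)
⋙-preserves-typing {Γ} (⋙-trans L⋙M M⋙N) unique typed =
  let (unique′ , typed′) = ⋙-preserves-typing {Γ} L⋙M unique typed in ⋙-preserves-typing {Γ} M⋙N unique′ typed′
⋙-preserves-typing {Γ} (⋙-mu {N = N}) unique typed = unique , retype-head {Γ} {N = N} ⊢-unfold typed
⋙-preserves-typing {Γ} (⋙-true {N = N} _) unique typed = unique , retype-head {Γ} {N = N} ⊢-ite-then typed
⋙-preserves-typing {Γ} (⋙-false {N = N} _) unique typed = unique , retype-head {Γ} {N = N} ⊢-ite-else typed

⋙-preserves-⊢s : ∀ {Γ M N} → M ⋙ N → Γ ⊢s M → Γ ⊢s N
⋙-preserves-⊢s {Γ} M⋙N (unique , typed , global) =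
  let (unique′ , typed′) = ⋙-preserves-typing {Γ} M⋙N unique typed in unique′ , typed′ , global

infixl 30 _[_↦_]
_[_↦_] : Env → Participant → Maybe LTy → Env
Γ [ r ↦ m ] = record { look = λ x → if x == r then m else look Γ x ; supp = r ∷ supp Γ ; fin = finite }
  where
  finite : ∀ x → (if x == r then m else look Γ x) ≢ nothing → x ∈ r ∷ supp Γ
  finite x defined with x == r in x=r
  ... | true = here (==-true⇒≡ x=r)
  ... | false = there (fin Γ x defined)

look-↦-≡ : ∀ Γ r m → look (Γ [ r ↦ m ]) r ≡ m
look-↦-≡ Γ r m rewrite ==-refl r = refl

look-↦-≢ : ∀ Γ r m {x} → x ≢ r → look (Γ [ r ↦ m ]) x ≡ look Γ x
look-↦-≢ Γ r m x≢r rewrite ≢⇒==-false x≢r = refl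

↦-agree : ∀ {Γ₁ Γ₂ r} p m → (∀ x → x ≢ r → look Γ₁ x ≡ look Γ₂ x)
  → ∀ x → x ≢ r → look (Γ₁ [ p ↦ m ]) x ≡ look (Γ₂ [ p ↦ m ]) x
↦-agree p m agree x x≢r with x == p
... | true = refl
... | false = agree x x≢r

∅ᴱ : Env
∅ᴱ = record { look = λ _ → nothing ; supp = [] ; fin = λ _ defined → ⊥-elim (defined refl) }

⟨_↦_⟩ : Participant → LTy → Env
⟨ r ↦ T ⟩ = ∅ᴱ [ r ↦ just T ]

Sing-⟨↦⟩ : ∀ r T → Sing ⟨ r ↦ T ⟩ r T
Sing-⟨↦⟩ r T = look-↦-≡ ∅ᴱ r (just T) , λ x x≢r → look-↦-≢ ∅ᴱ r (just T) x≢r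

≔-split : ∀ {Γ Γ₁ r T} → look Γ r ≡ just T → look Γ₁ r ≡ nothing
  → (∀ x → x ≢ r → look Γ₁ x ≡ look Γ x) → Γ ≔ Γ₁ ,, ⟨ r ↦ T ⟩
≔-split {r = r} Γr Γ₁r agree x with x == r in x=r
... | true rewrite ==-true⇒≡ x=r = inj₁ (Γ₁r , Γr)
... | false = inj₂ (refl , sym (agree x (==-false⇒≢ x=r)))

-- A step of p alone is framed into a whole environment by splitting off the other participants
-- one at a time, following a list that covers the domain.
module Frame {p T T′ α} (step : ∀ {Γ Γ′} → Sing Γ p T → Sing Γ′ p T′ → Γ —[ α ]→ Γ′) where

  Covers : Env → List Participant → Set
  Covers Γ L = ∀ x → x ≢ p → look Γ x ≢ nothing → x ∈ L

  Covers-tail : ∀ {Γ r L} → r ≡ p ⊎ look Γ r ≡ nothing → Covers Γ (r ∷ L) → Covers Γ L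
  Covers-tail r-unused covered x x≢p defined with covered x x≢p defined | r-unused
  ... | here refl | inj₁ x≡p = ⊥-elim (x≢p x≡p)
  ... | here refl | inj₂ undefined = ⊥-elim (defined undefined)
  ... | there x∈L | _ = x∈L

  Covers-remove : ∀ {Γ r L} → Covers Γ L → Covers (Γ [ r ↦ nothing ]) L
  Covers-remove {Γ} {r} covered x x≢p defined with x == r
  ... | true = ⊥-elim (defined refl)
  ... | false = covered x x≢p defined

  frame-over : ∀ L Γ → look Γ p ≡ just T → Covers Γ L → Γ —[ α ]→ Γ [ p ↦ just T′ ]
  frame-over [] Γ Γp covered =
    step (Γp , alone) (look-↦-≡ Γ p (just T′) , λ x x≢p → trans (look-↦-≢ Γ p (just T′) x≢p) (alone x x≢p))
    where
    alone : ∀ x → x ≢ p → look Γ x ≡ nothing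
    alone x x≢p with look Γ x | covered x x≢p
    ... | nothing | _ = refl
    ... | just _ | defined⇒x∈[] with defined⇒x∈[] (λ ())
    ...   | ()

  frame-over (r ∷ L) Γ Γp covered with r ≟ p | look Γ r in Γr
  ... | yes r≡p | _ = frame-over L Γ Γp (Covers-tail {Γ} (inj₁ r≡p) covered)
  ... | no _ | nothing = frame-over L Γ Γp (Covers-tail {Γ} (inj₂ Γr) covered)
  ... | no r≢p | just Tr =
    e-frame {Γ₁ = Γ₁} {Γ₁′} {⟨ r ↦ Tr ⟩}
            (≔-split {Γ} {Γ₁} Γr (look-↦-≡ Γ r nothing) (λ x → look-↦-≢ Γ r nothing))
            (Sing-⟨↦⟩ r Tr)
            (frame-over L Γ₁ Γ₁p (Covers-tail {Γ₁} (inj₂ (look-↦-≡ Γ r nothing)) (Covers-remove {Γ} covered)))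
            (≔-split {Γ [ p ↦ just T′ ]} {Γ₁′} (trans (look-↦-≢ Γ p (just T′) r≢p) Γr)
                     (trans (look-↦-≢ Γ₁ p (just T′) r≢p) (look-↦-≡ Γ r nothing))
                     (↦-agree {Γ₁} {Γ} p (just T′) (λ x → look-↦-≢ Γ r nothing)))
    where
    Γ₁ Γ₁′ : Env
    Γ₁ = Γ [ r ↦ nothing ]
    Γ₁′ = Γ₁ [ p ↦ just T′ ]
    Γ₁p : look Γ₁ p ≡ just T
    Γ₁p = trans (look-↦-≢ Γ r nothing (λ p≡r → r≢p (sym p≡r))) Γp

  frame : ∀ {Γ} → look Γ p ≡ just T → Γ —[ α ]→ Γ [ p ↦ just T′ ]
  frame {Γ} Γp = frame-over (supp Γ) Γ Γp (λ x _ → fin Γ x)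

com-step : ∀ {Γ p q ℓ Tp Tq bp bq} → p ≢ q → look Γ p ≡ just Tp → look Γ q ≡ just Tq
  → Tp [] ≡ hsel q bp → Tq [] ≡ hbra p bq → (kp : Fin (suc (n bp))) (kq : Fin (suc (n bq)))
  → lab bp kp ≡ ℓ → lab bq kq ≡ ℓ → srt bp kp ≤s srt bq kq
  → Γ —[ comL p q ℓ ]→ Γ [ p ↦ just (child Tp (toℕ kp)) ] [ q ↦ just (child Tq (toℕ kq)) ]
com-step {Γ} {p} {q} {Tp = Tp} {Tq} {bq = bq} p≢q Γp Γq Tp-sel Tq-bra kp kq refl ℓq S≤ =
  e-com {Γ₁ = Γ₁} {Γ₁′} {⟨ q ↦ Tq ⟩} {⟨ q ↦ Tq′ ⟩}
    (≔-split {Γ} {Γ₁} Γq (look-↦-≡ Γ q nothing) (λ x → look-↦-≢ Γ q nothing))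
    (Frame.frame (λ sing sing′ → e-out sing Tp-sel kp sing′) (trans (look-↦-≢ Γ q nothing p≢q) Γp))
    (subst (λ ℓ → ⟨ q ↦ Tq ⟩ —[ inL q p ℓ (srt bq kq) ]→ ⟨ q ↦ Tq′ ⟩) ℓq
           (e-in (Sing-⟨↦⟩ q Tq) Tq-bra kq (Sing-⟨↦⟩ q Tq′)))
    S≤
    (≔-split {Γ [ p ↦ just Tp′ ] [ q ↦ just Tq′ ]} {Γ₁′}
      (look-↦-≡ (Γ [ p ↦ just Tp′ ]) q (just Tq′))
      (trans (look-↦-≢ Γ₁ p (just Tp′) (λ q≡p → p≢q (sym q≡p))) (look-↦-≡ Γ q nothing))
      agree)
  where
  Tp′ Tq′ : LTy
  Tp′ = child Tp (toℕ kp)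
  Tq′ = child Tq (toℕ kq)
  Γ₁ Γ₁′ : Env
  Γ₁ = Γ [ q ↦ nothing ]
  Γ₁′ = Γ₁ [ p ↦ just Tp′ ]
  agree : ∀ x → x ≢ q → look Γ₁′ x ≡ look (Γ [ p ↦ just Tp′ ] [ q ↦ just Tq′ ]) x
  agree x x≢q = trans (↦-agree {Γ₁} {Γ} p (just Tp′) (λ y → look-↦-≢ Γ q nothing) x x≢q)
                      (sym (look-↦-≢ (Γ [ p ↦ just Tp′ ]) q (just Tq′) x≢q))

≗-child : ∀ {X Y : GTy} → X ≗ Y → ∀ i → child X i ≗ child Y i
≗-child X≗Y i π = X≗Y (i ∷ π)

≗-sym : ∀ {X Y : GTy} → X ≗ Y → Y ≗ X
≗-sym X≗Y π = sym (X≗Y π)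

≗-trans : ∀ {X Y Z : GTy} → X ≗ Y → Y ≗ Z → X ≗ Z
≗-trans X≗Y Y≗Z π = trans (X≗Y π) (Y≗Z π)

∈pt-resp-≗ : ∀ {X Y r} → X ≗ Y → r ∈pt Y → r ∈pt X
∈pt-resp-≗ X≗Y (pt-snd head) = pt-snd (trans (X≗Y []) head)
∈pt-resp-≗ X≗Y (pt-rcv head) = pt-rcv (trans (X≗Y []) head)
∈pt-resp-≗ X≗Y (pt-sub head i r∈) = pt-sub (trans (X≗Y []) head) i (∈pt-resp-≗ (≗-child X≗Y (toℕ i)) r∈)

VPath-resp-≗ : ∀ {X Y ρ} → X ≗ Y → VPath Y ρ → VPath X ρ
VPath-resp-≗ X≗Y vp-nil = vp-nil
VPath-resp-≗ X≗Y (vp-cons head i path) =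
  vp-cons (trans (X≗Y []) head) i (VPath-resp-≗ (≗-child X≗Y (toℕ i)) path)

Occ-resp-≗ : ∀ {X Y s ρ} → X ≗ Y → Occ s Y ρ → Occ s X ρ
Occ-resp-≗ X≗Y (occ-here head s∈) = occ-here (trans (X≗Y []) head) s∈
Occ-resp-≗ X≗Y (occ-there {i = i} occ) = occ-there (Occ-resp-≗ (≗-child X≗Y i) occ)


Balanced-child : ∀ {G p q b} → Balanced G → G [] ≡ gcom p q b → ∀ i → Balanced (child G (toℕ i))
Balanced-child balanced head i π path = balanced (toℕ i ∷ π) (vp-cons head i path)

maxᶠ : ∀ m → (Fin (suc m) → ℕ) → ℕ
maxᶠ zero f = f Fin.zero
maxᶠ (suc m) f = f Fin.zero ⊔ maxᶠ m (λ i → f (Fin.suc i))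

≤-maxᶠ : ∀ m f (i : Fin (suc m)) → f i ≤ maxᶠ m f
≤-maxᶠ zero f Fin.zero = ≤-refl
≤-maxᶠ (suc m) f Fin.zero = m≤m⊔n (f Fin.zero) _
≤-maxᶠ (suc m) f (Fin.suc i) = ≤-trans (≤-maxᶠ m (λ j → f (Fin.suc j)) i) (m≤n⊔m (f Fin.zero) _)

end? : (h : LHead) → Dec (h ≡ hend)
end? hend = yes refl
end? (hbra _ _) = no bra≢end
end? (hsel _ _) = no sel≢end

gcom-sender : ∀ {a c b a′ c′ b′} → gcom a c b ≡ gcom a′ c′ b′ → a ≡ a′
gcom-sender refl = refl

gcom-receiver : ∀ {a c b a′ c′ b′} → gcom a c b ≡ gcom a′ c′ b′ → c ≡ c′
gcom-receiver refl = refl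

OccursWithin : ℕ → Participant → GTy → Set
OccursWithin k s X = ∀ ρ → VPath X ρ → k ≤ length ρ ⊎ X ρ ≡ gend → Occ s X ρ

OccursWithin-resp-≗ : ∀ {k s X Y} → X ≗ Y → OccursWithin k s Y → OccursWithin k s X
OccursWithin-resp-≗ X≗Y occurs ρ path long =
  Occ-resp-≗ X≗Y (occurs ρ (VPath-resp-≗ (≗-sym X≗Y) path) (map₂ (trans (sym (X≗Y ρ))) long))

OccursWithin-mono : ∀ {k k′ s X} → k ≤ k′ → OccursWithin k s X → OccursWithin k′ s X
OccursWithin-mono k≤k′ occurs ρ path long = occurs ρ path (map₁ (≤-trans k≤k′) long)

OccursWithin-child : ∀ {d s X a c b} → X [] ≡ gcom a c b → s ≢ a → s ≢ c
  → OccursWithin (suc d) s X → ∀ (i : Fin (suc (n b))) → OccursWithin d s (child X (toℕ i))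
OccursWithin-child head s≢a s≢c occurs i ρ path long
  with occurs (toℕ i ∷ ρ) (vp-cons head i path) (map₁ s≤s long)
... | occ-here head′ (inj₁ s≡a) = ⊥-elim (s≢a (trans s≡a (gcom-sender (trans (sym head′) head))))
... | occ-here head′ (inj₂ s≡c) = ⊥-elim (s≢c (trans s≡c (gcom-receiver (trans (sym head′) head))))
... | occ-there occ = occ

OccursWithin-node : ∀ {s X a c b} (ks : Fin (suc (n b)) → ℕ) → X [] ≡ gcom a c b
  → (∀ i → OccursWithin (ks i) s (child X (toℕ i))) → OccursWithin (suc (maxᶠ (n b) ks)) s X
OccursWithin-node ks head occurs [] vp-nil (inj₁ ())
OccursWithin-node ks head occurs [] vp-nil (inj₂ X-end) with trans (sym head) X-end
... | ()
OccursWithin-node {b = b} ks head occurs (_ ∷ ρ) (vp-cons head′ i path) long with trans (sym head) head′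
... | refl = occ-there (occurs i ρ path (map₁ (λ { (s≤s max≤) → ≤-trans (≤-maxᶠ (n b) ks i) max≤ }) long))

BalancedAt-resp-≗ : ∀ {X Y} → X ≗ Y → BalancedAt Y → BalancedAt X
BalancedAt-resp-≗ X≗Y (k , occurs) =
  k , λ s s∈X → OccursWithin-resp-≗ X≗Y (occurs s (∈pt-resp-≗ (≗-sym X≗Y) s∈X))

ProjClosed : (GTy → Participant → LTy → Set) → Set
ProjClosed R = ∀ G r T → R G r T → ProjStep R G r T

ProjStep-mono : ∀ {R₁ R₂ : GTy → Participant → LTy → Set} → (∀ {G r T} → R₁ G r T → R₂ G r T)
  → ∀ {G r T} → ProjStep R₁ G r T → ProjStep R₂ G r T
ProjStep-mono R₁⊆R₂ (pr-end r∉ end) = pr-end r∉ end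
ProjStep-mono R₁⊆R₂ (pr-in head T-bra children) = pr-in head T-bra (λ i → R₁⊆R₂ (children i))
ProjStep-mono R₁⊆R₂ (pr-out head T-sel children) = pr-out head T-sel (λ i → R₁⊆R₂ (children i))
ProjStep-mono R₁⊆R₂ (pr-skip head r≢p r≢q r∈ children) = pr-skip head r≢p r≢q r∈ (λ i → R₁⊆R₂ (children i))

proj-∈pt⇒¬end : ∀ {R} → ProjClosed R → ∀ {G r T} → R G r T → r ∈pt G → T [] ≢ hend
proj-∈pt⇒¬end closed {G} {r} {T} proj r∈ T-end with closed G r T proj
... | pr-end r∉ _ = r∉ r∈
... | pr-in _ T-bra _ = bra≢end (trans (sym T-bra) T-end)
... | pr-out _ T-sel _ = sel≢end (trans (sym T-sel) T-end)
... | pr-skip head r≢p r≢q _ children = skipped r∈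
  where
  skipped : r ∈pt G → ⊥
  skipped (pt-snd head′) = r≢p (gcom-sender (trans (sym head′) head))
  skipped (pt-rcv head′) = r≢q (gcom-receiver (trans (sym head′) head))
  skipped (pt-sub head′ i r∈ᵢ) with trans (sym head′) head
  ... | refl = proj-∈pt⇒¬end closed (children i) r∈ᵢ T-end

proj-¬end⇒∈pt : ∀ {R} → ProjClosed R → ∀ {G r T} → R G r T → T [] ≢ hend → r ∈pt G
proj-¬end⇒∈pt closed {G} {r} {T} proj T-¬end with closed G r T proj
... | pr-end _ T-end = ⊥-elim (T-¬end T-end)
... | pr-in head _ _ = pt-rcv head
... | pr-out head _ _ = pt-snd head
... | pr-skip _ _ _ r∈ _ = r∈

proj-children : ∀ {R} → ProjClosed R → ∀ {G r T a c b} → R G r T → r ∈pt G → G [] ≡ gcom a c b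
  → ∀ (i : Fin (suc (n b))) → Σ LTy λ Tᵢ → R (child G (toℕ i)) r Tᵢ
proj-children closed {G} {r} {T} proj r∈ head i with closed G r T proj
... | pr-end r∉ _ = ⊥-elim (r∉ r∈)
... | pr-in head′ _ children with trans (sym head) head′
...   | refl = _ , children i
proj-children closed proj r∈ head i | pr-out head′ _ children with trans (sym head) head′
...   | refl = _ , children i
proj-children closed proj r∈ head i | pr-skip head′ _ _ _ children with trans (sym head) head′
...   | refl = _ , children i

gcom-branches : ∀ {a c b a′ c′ b′} → gcom a c b ≡ gcom a′ c′ b′ → b ≡ b′
gcom-branches refl = refl

sel≢bra : ∀ {p q b b′} → hsel q b ≢ hbra p b′
sel≢bra ()

-- Advancing a global type past the exchange p → q

module Redex (p q : Participant) (U V : LTy) (bU bV : Br)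
  (U-sel : U [] ≡ hsel q bU) (V-bra : V [] ≡ hbra p bV)
  {Rp Rq : GTy → Participant → LTy → Set} (Rp-closed : ProjClosed Rp) (Rq-closed : ProjClosed Rq) where

  Redex : GTy → Set
  Redex H = Rp H p U × Rq H q V

  data Shape (H : GTy) : Set where
    exchange : H [] ≡ gcom p q bU → bU ≡ bV
      → (∀ (i : Fin (suc (n bU))) → Rp (child H (toℕ i)) p (child U (toℕ i)))
      → (∀ (i : Fin (suc (n bV))) → Rq (child H (toℕ i)) q (child V (toℕ i))) → Shape H
    independent : ∀ {a c b} → H [] ≡ gcom a c b → p ≢ a → q ≢ a → p ≢ c → q ≢ c
      → (∀ (i : Fin (suc (n b))) → Redex (child H (toℕ i))) → Shape H

  -- Projections onto p and q only skip communications not involving them, so the first node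
  -- involving p or q is the exchange p → q itself.
  shape : ∀ {H} → Redex H → Shape H
  shape {H} (Rp-H , Rq-H) with Rp-closed H p U Rp-H | Rq-closed H q V Rq-H
  ... | pr-end _ U-end | _ = ⊥-elim (sel≢end (trans (sym U-sel) U-end))
  ... | pr-in _ U-bra _ | _ = ⊥-elim (sel≢bra (trans (sym U-sel) U-bra))
  ... | _ | pr-end _ V-end = ⊥-elim (bra≢end (trans (sym V-bra) V-end))
  ... | _ | pr-out _ V-sel _ = ⊥-elim (sel≢bra (trans (sym V-sel) V-bra))
  ... | pr-out head U-sel′ Us | pr-in head′ V-bra′ Vs with trans (sym U-sel) U-sel′ | trans (sym V-bra) V-bra′
  ...   | refl | refl = exchange head (gcom-branches (trans (sym head) head′)) Us Vs
  shape (Rp-H , Rq-H) | pr-out head U-sel′ _ | pr-skip head′ _ q≢c _ _ with trans (sym U-sel) U-sel′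
  ...   | refl = ⊥-elim (q≢c (gcom-receiver (trans (sym head) head′)))
  shape (Rp-H , Rq-H) | pr-skip head p≢a _ _ _ | pr-in head′ V-bra′ _ with trans (sym V-bra) V-bra′
  ...   | refl = ⊥-elim (p≢a (gcom-sender (trans (sym head′) head)))
  shape (Rp-H , Rq-H) | pr-skip head p≢a p≢c _ Rps | pr-skip head′ q≢a q≢c _ Rqs with trans (sym head) head′
  ...   | refl = independent head p≢a q≢a p≢c q≢c (λ i → Rps i , Rqs i)

  redex⇒p∈pt : ∀ {H} → Redex H → p ∈pt H
  redex⇒p∈pt (Rp-H , _) = proj-¬end⇒∈pt Rp-closed Rp-H (λ U-end → sel≢end (trans (sym U-sel) U-end))

  redex-branches-agree : ∀ {H} → Redex H → bU ≡ bV
  redex-branches-agree redex = agree (redex⇒p∈pt redex) redex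
    where
    agree : ∀ {H} → p ∈pt H → Redex H → bU ≡ bV
    agree p∈ redex with shape redex
    ... | exchange _ bU≡bV _ _ = bU≡bV
    agree (pt-snd head′) redex | independent head p≢a _ _ _ _ =
      ⊥-elim (p≢a (gcom-sender (trans (sym head′) head)))
    agree (pt-rcv head′) redex | independent head _ _ p≢c _ _ =
      ⊥-elim (p≢c (gcom-receiver (trans (sym head′) head)))
    agree (pt-sub head′ i p∈) redex | independent head _ _ _ _ redexes with trans (sym head′) head
    ... | refl = agree p∈ (redexes i)

module Advance (p q : Participant) (U V : LTy) (b : Br)
  (U-sel : U [] ≡ hsel q b) (V-bra : V [] ≡ hbra p b)
  {Rp Rq : GTy → Participant → LTy → Set} (Rp-closed : ProjClosed Rp) (Rq-closed : ProjClosed Rq)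
  (chosen : Fin (suc (n b))) where

  open Redex p q U V b b U-sel V-bra Rp-closed Rq-closed public

  m : ℕ
  m = toℕ chosen

  -- Performs the exchange along the branch chosen. Only senders are compared with p, which
  -- suffices under Redex. A child of advance H is only pointwise equal to the advanced child of H,
  -- hence the statements about any X ≗ advance H below.
  mutual
    advance : GTy → GTy
    advance G π = advance-at (G []) G π

    advance-at : GHead → GTy → List ℕ → GHead
    advance-at gend G π = G π
    advance-at (gcom a c b′) G [] = if a == p then G (m ∷ []) else gcom a c b′
    advance-at (gcom a c b′) G (j ∷ π) = if a == p then G (m ∷ j ∷ π) else advance (child G j) π

  advance-exchange : ∀ {X} H {c b′} → X ≗ advance H → H [] ≡ gcom p c b′ → X ≗ child H m
  advance-exchange H {c} {b′} X≗ head π =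
    trans (X≗ π) (subst (λ h → advance-at h H π ≡ H (m ∷ π)) (sym head) (at-p π))
    where
    at-p : ∀ π → advance-at (gcom p c b′) H π ≡ H (m ∷ π)
    at-p [] rewrite ==-refl p = refl
    at-p (j ∷ π) rewrite ==-refl p = refl

  advance-head : ∀ {X} H {a c b′} → X ≗ advance H → H [] ≡ gcom a c b′ → p ≢ a → X [] ≡ H []
  advance-head H {a} {c} {b′} X≗ head p≢a =
    trans (X≗ []) (subst (λ h → advance-at h H [] ≡ h) (sym head) at-a)
    where
    at-a : advance-at (gcom a c b′) H [] ≡ gcom a c b′
    at-a rewrite ≢⇒==-false (λ a≡p → p≢a (sym a≡p)) = refl

  advance-child : ∀ {X} H {a c b′} → X ≗ advance H → H [] ≡ gcom a c b′ → p ≢ a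
    → ∀ j → child X j ≗ advance (child H j)
  advance-child H {a} {c} {b′} X≗ head p≢a j π =
    trans (X≗ (j ∷ π)) (subst (λ h → advance-at h H (j ∷ π) ≡ advance (child H j) π) (sym head) at-a)
    where
    at-a : advance-at (gcom a c b′) H (j ∷ π) ≡ advance (child H j) π
    at-a rewrite ≢⇒==-false (λ a≡p → p≢a (sym a≡p)) = refl

  ∈pt-advance⁻ : ∀ {r X} H → Redex H → X ≗ advance H → r ∈pt X → r ∈pt H
  ∈pt-advance⁻ H redex X≗ r∈ with shape redex
  ... | exchange head _ _ _ = pt-sub head chosen (∈pt-resp-≗ (≗-sym (advance-exchange H X≗ head)) r∈)
  ∈pt-advance⁻ H redex X≗ (pt-snd head′) | independent head p≢a _ _ _ _ =
    pt-snd (trans (sym (advance-head H X≗ head p≢a)) head′)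
  ∈pt-advance⁻ H redex X≗ (pt-rcv head′) | independent head p≢a _ _ _ _ =
    pt-rcv (trans (sym (advance-head H X≗ head p≢a)) head′)
  ∈pt-advance⁻ H redex X≗ (pt-sub head′ i r∈) | independent head p≢a _ _ _ redexes
    with trans (sym head) (trans (sym (advance-head H X≗ head p≢a)) head′)
  ... | refl = pt-sub head i
                 (∈pt-advance⁻ (child H (toℕ i)) (redexes i) (advance-child H X≗ head p≢a (toℕ i)) r∈)

  ∈pt-advance⁺ : ∀ {r X T} {R : GTy → Participant → LTy → Set} H → ProjClosed R → r ≢ p → r ≢ q
    → Redex H → R H r T → X ≗ advance H → r ∈pt H → r ∈pt X
  ∈pt-advance⁺ {r} {T = T} {R} H closed r≢p r≢q redex proj X≗ r∈ with shape redex
  ... | exchange head _ _ _ =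
    ∈pt-resp-≗ (advance-exchange H X≗ head) (proj-¬end⇒∈pt closed (continued (closed H r T proj)) T-¬end)
    where
    T-¬end : T [] ≢ hend
    T-¬end = proj-∈pt⇒¬end closed proj r∈
    continued : ProjStep R H r T → R (child H m) r T
    continued (pr-end r∉ _) = ⊥-elim (r∉ r∈)
    continued (pr-in head′ _ _) = ⊥-elim (r≢q (sym (gcom-receiver (trans (sym head) head′))))
    continued (pr-out head′ _ _) = ⊥-elim (r≢p (sym (gcom-sender (trans (sym head) head′))))
    continued (pr-skip head′ _ _ _ children) with trans (sym head) head′
    ... | refl = children chosen
  ∈pt-advance⁺ H closed r≢p r≢q redex proj X≗ (pt-snd head′) | independent head p≢a _ _ _ _ =
    pt-snd (trans (advance-head H X≗ head p≢a) head′)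
  ∈pt-advance⁺ H closed r≢p r≢q redex proj X≗ (pt-rcv head′) | independent head p≢a _ _ _ _ =
    pt-rcv (trans (advance-head H X≗ head p≢a) head′)
  ∈pt-advance⁺ H closed r≢p r≢q redex proj X≗ (pt-sub head′ i r∈) | independent head p≢a _ _ _ redexes
    with trans (sym head) head′
  ... | refl = pt-sub (trans (advance-head H X≗ head p≢a) head′) i
                 (∈pt-advance⁺ (child H (toℕ i)) closed r≢p r≢q (redexes i)
                    (proj₂ (proj-children closed proj (pt-sub head′ i r∈) head i))
                    (advance-child H X≗ head p≢a (toℕ i)) r∈)

  endpoint-≢ : ∀ {s a} → s ≡ p ⊎ s ≡ q → p ≢ a → q ≢ a → s ≢ a
  endpoint-≢ (inj₁ refl) p≢a _ = p≢a
  endpoint-≢ (inj₂ refl) _ q≢a = q≢a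

  module Endpoint (s : Participant) (s-endpoint : s ≡ p ⊎ s ≡ q) (W : LTy)
    {Rs : GTy → Participant → LTy → Set} (Rs-closed : ProjClosed Rs)
    (continues : ∀ {H} → (∀ (i : Fin (suc (n b))) → Rp (child H (toℕ i)) p (child U (toℕ i)))
                       → (∀ (i : Fin (suc (n b))) → Rq (child H (toℕ i)) q (child V (toℕ i)))
                       → Rs (child H m) s (child W m)) where

    ∈pt-advance : ∀ {X} H → Redex H → child W m [] ≢ hend → X ≗ advance H → s ∈pt X
    ∈pt-advance H redex W-¬end = go H (redex⇒p∈pt redex) redex
      where
      go : ∀ {X} H → p ∈pt H → Redex H → X ≗ advance H → s ∈pt X
      go H p∈ redex X≗ with shape redex
      ... | exchange head _ Us Vs =
        ∈pt-resp-≗ (advance-exchange H X≗ head) (proj-¬end⇒∈pt Rs-closed (continues {H} Us Vs) W-¬end)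
      go H (pt-snd head′) redex X≗ | independent head p≢a _ _ _ _ =
        ⊥-elim (p≢a (gcom-sender (trans (sym head′) head)))
      go H (pt-rcv head′) redex X≗ | independent head _ _ p≢c _ _ =
        ⊥-elim (p≢c (gcom-receiver (trans (sym head′) head)))
      go H (pt-sub head′ i p∈) redex X≗ | independent head p≢a _ _ _ redexes with trans (sym head′) head
      ... | refl = pt-sub (trans (advance-head H X≗ head p≢a) head) i
                     (go (child H (toℕ i)) p∈ (redexes i) (advance-child H X≗ head p≢a (toℕ i)))

    ∉pt-advance : ∀ {X} H → Redex H → child W m [] ≡ hend → X ≗ advance H → ¬ s ∈pt X
    ∉pt-advance H redex W-end X≗ s∈ with shape redex
    ... | exchange head _ Us Vs =
      proj-∈pt⇒¬end Rs-closed (continues {H} Us Vs) (∈pt-resp-≗ (≗-sym (advance-exchange H X≗ head)) s∈) W-end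
    ∉pt-advance H redex W-end X≗ (pt-snd head′) | independent head p≢a q≢a _ _ _ =
      endpoint-≢ s-endpoint p≢a q≢a (gcom-sender (trans (sym head′) (trans (advance-head H X≗ head p≢a) head)))
    ∉pt-advance H redex W-end X≗ (pt-rcv head′) | independent head p≢a _ p≢c q≢c _ =
      endpoint-≢ s-endpoint p≢c q≢c (gcom-receiver (trans (sym head′) (trans (advance-head H X≗ head p≢a) head)))
    ∉pt-advance H redex W-end X≗ (pt-sub head′ i s∈) | independent head p≢a _ _ _ redexes
      with trans (sym head) (trans (sym (advance-head H X≗ head p≢a)) head′)
    ... | refl = ∉pt-advance (child H (toℕ i)) (redexes i) W-end (advance-child H X≗ head p≢a (toℕ i)) s∈

  module p-endpoint = Endpoint p (inj₁ refl) U Rp-closed (λ Us _ → Us chosen)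
  module q-endpoint = Endpoint q (inj₂ refl) V Rq-closed (λ _ Vs → Vs chosen)

  module Projection {Rr : GTy → Participant → LTy → Set} (Rr-closed : ProjClosed Rr) where

    Unchanged : GTy → Participant → LTy → Set
    Unchanged Y s T = Rr Y s T ⊎ Rp Y s T ⊎ Rq Y s T

    Unchanged-closed : ProjClosed Unchanged
    Unchanged-closed Y s T (inj₁ proj) = ProjStep-mono inj₁ (Rr-closed Y s T proj)
    Unchanged-closed Y s T (inj₂ (inj₁ proj)) = ProjStep-mono (λ r → inj₂ (inj₁ r)) (Rp-closed Y s T proj)
    Unchanged-closed Y s T (inj₂ (inj₂ proj)) = ProjStep-mono (λ r → inj₂ (inj₂ r)) (Rq-closed Y s T proj)

    Expected : GTy → Participant → LTy → Set
    Expected H s T = (s ≢ p × s ≢ q × Rr H s T) ⊎ (s ≡ p × T ≡ child U m) ⊎ (s ≡ q × T ≡ child V m)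

    -- Above the exchange, advance G is related to its projections through Expected; below it, the
    -- subtrees are those of G with their own projections.
    Advanced : GTy → Participant → LTy → Set
    Advanced X s T = (Σ GTy λ H → X ≗ advance H × Redex H × Expected H s T)
                   ⊎ (Σ GTy λ Y → X ≗ Y × Unchanged Y s T)

    unchanged-step : ∀ {X Y s T} → X ≗ Y → ProjStep Unchanged Y s T → ProjStep Advanced X s T
    unchanged-step X≗Y (pr-end s∉ T-end) = pr-end (λ s∈ → s∉ (∈pt-resp-≗ (≗-sym X≗Y) s∈)) T-end
    unchanged-step X≗Y (pr-in head T-bra children) =
      pr-in (trans (X≗Y []) head) T-bra (λ i → inj₂ (_ , ≗-child X≗Y (toℕ i) , children i))
    unchanged-step X≗Y (pr-out head T-sel children) =
      pr-out (trans (X≗Y []) head) T-sel (λ i → inj₂ (_ , ≗-child X≗Y (toℕ i) , children i))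
    unchanged-step X≗Y (pr-skip head s≢a s≢c s∈ children) =
      pr-skip (trans (X≗Y []) head) s≢a s≢c (∈pt-resp-≗ X≗Y s∈)
              (λ i → inj₂ (_ , ≗-child X≗Y (toℕ i) , children i))

    exchange-step : ∀ {X s T} H → X ≗ advance H → H [] ≡ gcom p q b
      → (∀ (i : Fin (suc (n b))) → Rp (child H (toℕ i)) p (child U (toℕ i)))
      → (∀ (i : Fin (suc (n b))) → Rq (child H (toℕ i)) q (child V (toℕ i)))
      → Redex H → Expected H s T → ProjStep Advanced X s T
    exchange-step {s = s} {T} H X≗ head Us Vs redex (inj₁ (s≢p , s≢q , Rr-H)) with Rr-closed H s T Rr-H
    ... | pr-end s∉ T-end = pr-end (λ s∈ → s∉ (∈pt-advance⁻ H redex X≗ s∈)) T-end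
    ... | pr-in head′ _ _ = ⊥-elim (s≢q (sym (gcom-receiver (trans (sym head) head′))))
    ... | pr-out head′ _ _ = ⊥-elim (s≢p (sym (gcom-sender (trans (sym head) head′))))
    ... | pr-skip head′ _ _ _ children with trans (sym head) head′
    ...   | refl = unchanged-step (advance-exchange H X≗ head) (Unchanged-closed _ s T (inj₁ (children chosen)))
    exchange-step H X≗ head Us Vs redex (inj₂ (inj₁ (refl , refl))) =
      unchanged-step (advance-exchange H X≗ head) (Unchanged-closed _ p _ (inj₂ (inj₁ (Us chosen))))
    exchange-step H X≗ head Us Vs redex (inj₂ (inj₂ (refl , refl))) =
      unchanged-step (advance-exchange H X≗ head) (Unchanged-closed _ q _ (inj₂ (inj₂ (Vs chosen))))

    descend : ∀ {X a c b′ s} {Ts : Fin (suc (n b′)) → LTy} H → X ≗ advance H → H [] ≡ gcom a c b′ → p ≢ a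
      → (∀ i → Redex (child H (toℕ i))) → (∀ i → Expected (child H (toℕ i)) s (Ts i))
      → ∀ i → Advanced (child X (toℕ i)) s (Ts i)
    descend H X≗ head p≢a redexes expected i =
      inj₁ (child H (toℕ i) , advance-child H X≗ head p≢a (toℕ i) , redexes i , expected i)

    endpoint-step : ∀ {X a c b′ s} H W → X ≗ advance H → H [] ≡ gcom a c b′ → p ≢ a → s ≢ a → s ≢ c
      → (∀ (i : Fin (suc (n b′))) → Advanced (child X (toℕ i)) s (child W m))
      → (child W m [] ≡ hend → ¬ s ∈pt X) → (child W m [] ≢ hend → s ∈pt X)
      → ProjStep Advanced X s (child W m)
    endpoint-step H W X≗ head p≢a s≢a s≢c children absent present with end? (child W m [])
    ... | yes W-end = pr-end (absent W-end) W-end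
    ... | no W-¬end = pr-skip (trans (advance-head H X≗ head p≢a) head) s≢a s≢c (present W-¬end) children

    independent-step : ∀ {X a c b′ s T} H → X ≗ advance H → H [] ≡ gcom a c b′
      → p ≢ a → q ≢ a → p ≢ c → q ≢ c → (∀ (i : Fin (suc (n b′))) → Redex (child H (toℕ i)))
      → Redex H → Expected H s T → ProjStep Advanced X s T
    independent-step {s = s} {T} H X≗ head p≢a q≢a p≢c q≢c redexes redex (inj₁ (s≢p , s≢q , Rr-H))
      with Rr-closed H s T Rr-H
    ... | pr-end s∉ T-end = pr-end (λ s∈ → s∉ (∈pt-advance⁻ H redex X≗ s∈)) T-end
    ... | pr-in head′ T-bra children with trans (sym head) head′
    ...   | refl = pr-in (trans (advance-head H X≗ head p≢a) head′) T-bra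
                         (descend H X≗ head p≢a redexes (λ i → inj₁ (s≢p , s≢q , children i)))
    independent-step H X≗ head p≢a q≢a p≢c q≢c redexes redex (inj₁ (s≢p , s≢q , Rr-H))
      | pr-out head′ T-sel children with trans (sym head) head′
    ...   | refl = pr-out (trans (advance-head H X≗ head p≢a) head′) T-sel
                          (descend H X≗ head p≢a redexes (λ i → inj₁ (s≢p , s≢q , children i)))
    independent-step H X≗ head p≢a q≢a p≢c q≢c redexes redex (inj₁ (s≢p , s≢q , Rr-H))
      | pr-skip head′ s≢a s≢c s∈ children with trans (sym head) head′
    ...   | refl = pr-skip (trans (advance-head H X≗ head p≢a) head′) s≢a s≢c
                           (∈pt-advance⁺ H Rr-closed s≢p s≢q redex Rr-H X≗ s∈)
                           (descend H X≗ head p≢a redexes (λ i → inj₁ (s≢p , s≢q , children i)))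
    independent-step H X≗ head p≢a q≢a p≢c q≢c redexes redex (inj₂ (inj₁ (refl , refl))) =
      endpoint-step H U X≗ head p≢a p≢a p≢c (descend H X≗ head p≢a redexes (λ _ → inj₂ (inj₁ (refl , refl))))
                    (λ U-end → p-endpoint.∉pt-advance H redex U-end X≗)
                    (λ U-¬end → p-endpoint.∈pt-advance H redex U-¬end X≗)
    independent-step H X≗ head p≢a q≢a p≢c q≢c redexes redex (inj₂ (inj₂ (refl , refl))) =
      endpoint-step H V X≗ head p≢a q≢a q≢c (descend H X≗ head p≢a redexes (λ _ → inj₂ (inj₂ (refl , refl))))
                    (λ V-end → q-endpoint.∉pt-advance H redex V-end X≗)
                    (λ V-¬end → q-endpoint.∈pt-advance H redex V-¬end X≗)

    Advanced-closed : ProjClosed Advanced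
    Advanced-closed X s T (inj₂ (Y , X≗Y , unchanged)) = unchanged-step X≗Y (Unchanged-closed Y s T unchanged)
    Advanced-closed X s T (inj₁ (H , X≗ , redex , expected)) with shape redex
    ... | exchange head _ Us Vs = exchange-step H X≗ head Us Vs redex expected
    ... | independent head p≢a q≢a p≢c q≢c redexes =
      independent-step H X≗ head p≢a q≢a p≢c q≢c redexes redex expected

    Proj-advance : ∀ {G s T} → Redex G → Expected G s T → Proj (advance G) s T
    Proj-advance {G} redex expected = Advanced , Advanced-closed , inj₁ (G , (λ _ → refl) , redex , expected)

  record PathImage (X H : GTy) (ρ : List ℕ) : Set where
    constructor pathImage
    field
      image       : List ℕ
      valid       : VPath H image
      longer      : length ρ ≤ length image
      same-node   : X ρ ≡ H image
      occurrences : ∀ s → s ≢ p → s ≢ q → Occ s H image → Occ s X ρ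

  advance-path : ∀ {X} H ρ → Redex H → X ≗ advance H → VPath X ρ → PathImage X H ρ
  advance-path {X} H ρ redex X≗ path with shape redex
  ... | exchange head _ _ _ =
    pathImage (m ∷ ρ) (vp-cons head chosen (VPath-resp-≗ (≗-sym X≗H₁) path)) (n≤1+n (length ρ)) (X≗H₁ ρ) occurs
    where
    X≗H₁ : X ≗ child H m
    X≗H₁ = advance-exchange H X≗ head
    occurs : ∀ s → s ≢ p → s ≢ q → Occ s H (m ∷ ρ) → Occ s X ρ
    occurs s s≢p _ (occ-here head′ (inj₁ s≡a)) = ⊥-elim (s≢p (trans s≡a (gcom-sender (trans (sym head′) head))))
    occurs s _ s≢q (occ-here head′ (inj₂ s≡c)) = ⊥-elim (s≢q (trans s≡c (gcom-receiver (trans (sym head′) head))))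
    occurs s s≢p s≢q (occ-there occ) = Occ-resp-≗ X≗H₁ occ
  advance-path H [] redex X≗ vp-nil | independent head p≢a _ _ _ _ =
    pathImage [] vp-nil z≤n (advance-head H X≗ head p≢a) (λ _ _ _ ())
  advance-path {X} H (_ ∷ ρ) redex X≗ (vp-cons head′ i path) | independent head p≢a _ _ _ redexes
    with trans (sym head) (trans (sym (advance-head H X≗ head p≢a)) head′)
  ... | refl with advance-path (child H (toℕ i)) ρ (redexes i) (advance-child H X≗ head p≢a (toℕ i)) path
  ...   | pathImage ρ′ valid longer same-node occurrences =
    pathImage (toℕ i ∷ ρ′) (vp-cons head i valid) (s≤s longer) same-node occurs
    where
    occurs : ∀ s → s ≢ p → s ≢ q → Occ s H (toℕ i ∷ ρ′) → Occ s X (toℕ i ∷ ρ)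
    occurs s _ _ (occ-here head″ s∈) = occ-here (trans (advance-head H X≗ head p≢a) head″) s∈
    occurs s s≢p s≢q (occ-there occ) = occ-there (occurrences s s≢p s≢q occ)

  WellFormed-advance : ∀ {G} → Redex G → WellFormed G → WellFormed (advance G)
  WellFormed-advance {G} redex wf π path a c b′ node with advance-path G π redex (λ _ → refl) path
  ... | pathImage π′ valid _ same-node _ = wf π′ valid a c b′ (trans (sym same-node) node)

  OccursWithin-advance : ∀ {k s} H → s ≢ p → s ≢ q → Redex H → OccursWithin k s H → OccursWithin k s (advance H)
  OccursWithin-advance H s≢p s≢q redex occurs ρ path long with advance-path H ρ redex (λ _ → refl) path
  ... | pathImage ρ′ valid longer same-node occurrences =
    occurrences _ s≢p s≢q (occurs ρ′ valid (map-⊎ (λ k≤ → ≤-trans k≤ longer) (trans (sym same-node)) long))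

  -- Whether an endpoint occurs in an advanced redex depends only on whether its continuation is end.
  endpoint-∈pt-transfer : ∀ {s X Y} H H′ → s ≡ p ⊎ s ≡ q → Redex H → X ≗ advance H → s ∈pt X
    → Redex H′ → Y ≗ advance H′ → s ∈pt Y
  endpoint-∈pt-transfer H H′ (inj₁ refl) redex X≗ p∈ redex′ Y≗ with end? (child U m [])
  ... | yes U-end = ⊥-elim (p-endpoint.∉pt-advance H redex U-end X≗ p∈)
  ... | no U-¬end = p-endpoint.∈pt-advance H′ redex′ U-¬end Y≗
  endpoint-∈pt-transfer H H′ (inj₂ refl) redex X≗ q∈ redex′ Y≗ with end? (child V m [])
  ... | yes V-end = ⊥-elim (q-endpoint.∉pt-advance H redex V-end X≗ q∈)
  ... | no V-¬end = q-endpoint.∈pt-advance H′ redex′ V-¬end Y≗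

  EndpointsWithin : ℕ → GTy → Set
  EndpointsWithin k H = ∀ {s X} → s ≡ p ⊎ s ≡ q → X ≗ advance H → s ∈pt X → OccursWithin k s X

  -- Since p occurs within d steps on every path of H, the exchange sits at depth below d, so the
  -- recursion over the independent communications above it is bounded by d.
  endpoints-bounded : ∀ d H → Redex H → Balanced H → OccursWithin d p H → Σ ℕ λ k → EndpointsWithin k H
  endpoints-bounded d H redex balanced p-within with shape redex
  ... | exchange head _ _ _ with balanced (m ∷ []) (vp-cons head chosen vp-nil)
  ...   | k , occurs = k , λ _ X≗ s∈ →
    let X≗H₁ = advance-exchange H X≗ head in OccursWithin-resp-≗ X≗H₁ (occurs _ (∈pt-resp-≗ (≗-sym X≗H₁) s∈))
  endpoints-bounded zero H redex balanced p-within | independent _ _ _ _ _ _ with p-within [] vp-nil (inj₁ z≤n)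
  ... | ()
  endpoints-bounded (suc d) H redex balanced p-within | independent {b = b′} head p≢a _ p≢c _ redexes =
    suc (maxᶠ (n b′) (λ i → proj₁ (child-bound i))) , within
    where
    child-bound : ∀ (i : Fin (suc (n b′))) → Σ ℕ λ k → EndpointsWithin k (child H (toℕ i))
    child-bound i = endpoints-bounded d (child H (toℕ i)) (redexes i) (Balanced-child balanced head i)
                      (OccursWithin-child head p≢a p≢c p-within i)
    within : EndpointsWithin (suc (maxᶠ (n b′) (λ i → proj₁ (child-bound i)))) H
    within endpoint X≗ s∈ =
      OccursWithin-node (λ i → proj₁ (child-bound i)) (trans (advance-head H X≗ head p≢a) head) λ i →
        let X≗ᵢ = advance-child H X≗ head p≢a (toℕ i) in
        proj₂ (child-bound i) endpoint X≗ᵢ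
          (endpoint-∈pt-transfer H (child H (toℕ i)) endpoint redex X≗ s∈ (redexes i) X≗ᵢ)

  BalancedAt-advance : ∀ H → Redex H → Balanced H → BalancedAt (advance H)
  BalancedAt-advance H redex balanced with balanced [] vp-nil
  ... | k , occurs with endpoints-bounded k H redex balanced (occurs p (redex⇒p∈pt redex))
  ...   | k′ , endpoint-occurs = k ⊔ k′ , within
    where
    within : ∀ s → s ∈pt advance H → OccursWithin (k ⊔ k′) s (advance H)
    within s s∈ with s ≟ p | s ≟ q
    ... | yes s≡p | _ = OccursWithin-mono (m≤n⊔m k k′) (endpoint-occurs (inj₁ s≡p) (λ _ → refl) s∈)
    ... | no _ | yes s≡q = OccursWithin-mono (m≤n⊔m k k′) (endpoint-occurs (inj₂ s≡q) (λ _ → refl) s∈)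
    ... | no s≢p | no s≢q = OccursWithin-mono (m≤m⊔n k k′)
      (OccursWithin-advance H s≢p s≢q redex (occurs s (∈pt-advance⁻ H redex (λ _ → refl) s∈)))

  Balanced-at-advance : ∀ {X} H π → Redex H → Balanced H → X ≗ advance H → VPath X π → BalancedAt (at X π)
  Balanced-at-advance H π redex balanced X≗ path with shape redex
  ... | exchange head _ _ _ =
    BalancedAt-resp-≗ (λ ρ → advance-exchange H X≗ head (π ++ ρ))
      (balanced (m ∷ π) (vp-cons head chosen (VPath-resp-≗ (≗-sym (advance-exchange H X≗ head)) path)))
  Balanced-at-advance H [] redex balanced X≗ vp-nil | independent _ _ _ _ _ _ =
    BalancedAt-resp-≗ X≗ (BalancedAt-advance H redex balanced)
  Balanced-at-advance H (_ ∷ π) redex balanced X≗ (vp-cons head′ i path) | independent head p≢a _ _ _ redexes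
    with trans (sym head) (trans (sym (advance-head H X≗ head p≢a)) head′)
  ... | refl = Balanced-at-advance (child H (toℕ i)) π (redexes i) (Balanced-child balanced head i)
                 (advance-child H X≗ head p≢a (toℕ i)) path

  Balanced-advance : ∀ {G} → Redex G → Balanced G → Balanced (advance G)
  Balanced-advance {G} redex balanced π = Balanced-at-advance G π redex balanced (λ _ → refl)

  open Projection using (Proj-advance)

  Projectable-advance : ∀ {G} → Redex G → Projectable G → Projectable (advance G)
  Projectable-advance redex projectable r with r ≟ p | r ≟ q
  ... | yes refl | _ = child U m , Proj-advance Rp-closed redex (inj₂ (inj₁ (refl , refl)))
  ... | no _ | yes refl = child V m , Proj-advance Rq-closed redex (inj₂ (inj₂ (refl , refl)))
  ... | no r≢p | no r≢q with projectable r
  ...   | T , R , closed , proj = T , Proj-advance closed redex (inj₁ (r≢p , r≢q , proj))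

  module Association {Γ Γ′ : Env} {Tp′ Tq′ : LTy}
    (Γ′p : look Γ′ p ≡ just Tp′) (Γ′q : look Γ′ q ≡ just Tq′)
    (Γ′-others : ∀ r → r ≢ p → r ≢ q → look Γ′ r ≡ look Γ r)
    (Tp′≤ : Tp′ ≤L child U m) (Tq′≤ : Tq′ ≤L child V m) {G : GTy} (redex : Redex G) where

    present : (∀ r → r ∈pt G → Σ LTy λ T → look Γ r ≡ just T × Σ LTy λ U′ → Proj G r U′ × T ≤L U′)
      → ∀ r → r ∈pt advance G → Σ LTy λ T → look Γ′ r ≡ just T × Σ LTy λ U′ → Proj (advance G) r U′ × T ≤L U′
    present present-G r r∈ with r ≟ p | r ≟ q
    ... | yes refl | _ = Tp′ , Γ′p , child U m , Proj-advance Rp-closed redex (inj₂ (inj₁ (refl , refl))) , Tp′≤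
    ... | no _ | yes refl = Tq′ , Γ′q , child V m , Proj-advance Rq-closed redex (inj₂ (inj₂ (refl , refl))) , Tq′≤
    ... | no r≢p | no r≢q with present-G r (∈pt-advance⁻ G redex (λ _ → refl) r∈)
    ...   | T , Γr , Ur , (R , closed , proj) , T≤ =
      T , trans (Γ′-others r r≢p r≢q) Γr , Ur , Proj-advance closed redex (inj₁ (r≢p , r≢q , proj)) , T≤

    absent : Projectable G
      → (∀ r → ¬ r ∈pt G → look Γ r ≡ nothing ⊎ Σ LTy λ T → look Γ r ≡ just T × T [] ≡ hend)
      → ∀ r → ¬ r ∈pt advance G → look Γ′ r ≡ nothing ⊎ Σ LTy λ T → look Γ′ r ≡ just T × T [] ≡ hend
    absent projectable absent-G r r∉ with r ≟ p | r ≟ q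
    ... | yes refl | _ with end? (child U m [])
    ...   | yes U-end = inj₂ (Tp′ , Γ′p , ≤L-end-inv Tp′≤ U-end)
    ...   | no U-¬end = ⊥-elim (r∉ (p-endpoint.∈pt-advance G redex U-¬end (λ _ → refl)))
    absent projectable absent-G r r∉ | no _ | yes refl with end? (child V m [])
    ...   | yes V-end = inj₂ (Tq′ , Γ′q , ≤L-end-inv Tq′≤ V-end)
    ...   | no V-¬end = ⊥-elim (r∉ (q-endpoint.∈pt-advance G redex V-¬end (λ _ → refl)))
    absent projectable absent-G r r∉ | no r≢p | no r≢q with projectable r
    ...   | T , R , closed , proj =
      map-⊎ (trans (Γ′-others r r≢p r≢q)) (λ { (T , Γr , T-end) → T , trans (Γ′-others r r≢p r≢q) Γr , T-end })
            (absent-G r (λ r∈ → r∉ (∈pt-advance⁺ G closed r≢p r≢q redex proj (λ _ → refl) r∈)))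

    ⊑-advance : Projectable G → Γ ⊑ G → Γ′ ⊑ advance G
    ⊑-advance projectable (present-G , absent-G) = present present-G , absent projectable absent-G

-- If r were absent from G, its projection would be end and association would force T to be end.
⊑-∈pt : ∀ {Γ G r T} → Projectable G → Γ ⊑ G → look Γ r ≡ just T → T [] ≢ hend → r ∈pt G
⊑-∈pt {r = r} projectable (_ , absent) Γr T-¬end with projectable r
... | U , R , closed , proj with end? (U [])
...   | no U-¬end = proj-¬end⇒∈pt closed proj U-¬end
...   | yes U-end with absent r (λ r∈ → proj-∈pt⇒¬end closed proj r∈ U-end)
...     | inj₁ Γr-undefined with trans (sym Γr) Γr-undefined
...       | ()
⊑-∈pt projectable (_ , absent) Γr T-¬end | U , R , closed , proj | yes U-end | inj₂ (T′ , Γr′ , T′-end) =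
  ⊥-elim (T-¬end (subst (λ T → T [] ≡ hend) (just-injective (trans (sym Γr′) Γr)) T′-end))

⊑-proj : ∀ {Γ G r T} → Γ ⊑ G → look Γ r ≡ just T → r ∈pt G → Σ LTy λ U → Proj G r U × T ≤L U
⊑-proj (present , _) Γr r∈ with present _ r∈
... | T′ , Γr′ , U , proj , T′≤U with trans (sym Γr) Γr′
...   | refl = U , proj , T′≤U

comm-components-typed : ∀ {Γ Γ′ p q P P′ Q Q′ N Tp′ Tq′}
  → Unique (names ((q ◁ P) ∥ (p ◁ Q) ∥ N)) → ComponentsTyped Γ ((q ◁ P) ∥ (p ◁ Q) ∥ N)
  → look Γ′ q ≡ just Tq′ → ∅ ⊢ P′ ∶ Tq′ → look Γ′ p ≡ just Tp′ → ∅ ⊢ Q′ ∶ Tp′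
  → (∀ r → r ≢ p → r ≢ q → look Γ′ r ≡ look Γ r)
  → ComponentsTyped Γ′ ((q ◁ P′) ∥ (p ◁ Q′) ∥ N)
comm-components-typed _ _ Γ′q ⊢P′ _ _ _ (here refl) = _ , Γ′q , ⊢P′
comm-components-typed _ _ _ _ Γ′p ⊢Q′ _ (there (here refl)) = _ , Γ′p , ⊢Q′
comm-components-typed {N = N} ((_ ∷ q∉N) ∷ p∉N ∷ _) typed _ _ _ _ others {r} (there (there r∈N)) =
  let (T , Γr , ⊢R) = typed (there (there r∈N)) in T , trans (others r (fresh p∉N) (fresh q∉N)) Γr , ⊢R
  where
  fresh : ∀ {s} → All (s ≢_) (names N) → r ≢ s
  fresh s∉N = ≢-sym (All.lookup s∉N (∈-map⁺ proj₁ r∈N))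

comm-preserves-typing : ∀ {Γ p q m ls xs Ps e Q N v} (j : Fin (suc m)) → e ↓ v
  → Γ ⊢s ((q ◁ recv p m ls xs Ps) ∥ (p ◁ send q (ls j) e Q) ∥ N)
  → Σ Env λ Γ′ → (Γ —[ comL p q (ls j) ]→ Γ′) × (Γ′ ⊢s ((q ◁ substV (Ps j) v (xs j)) ∥ (p ◁ Q) ∥ N))
comm-preserves-typing {Γ} {p} {q} {xs = xs} {Ps} {N = N} {v} j e↓v
  (unique@((q≢p ∷ _) ∷ _) , typed , G , balanced , wf , projectable , assoc)
  with typed (here refl) | typed (there (here refl))
... | Tq , Γq , ⊢recv | Tp , Γp , ⊢send with ⊢-recv-inv ⊢recv | ⊢-send-inv ⊢send
... | recvTyping bq Tq-bra inj Ss branch | sendTyping bp Tp-sel kp ℓp S ⊢e S≤ ⊢Q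
  with ⊑-proj {Γ} assoc Γp (⊑-∈pt {Γ} projectable assoc Γp (λ Tp-end → sel≢end (trans (sym Tp-sel) Tp-end)))
     | ⊑-proj {Γ} assoc Γq (⊑-∈pt {Γ} projectable assoc Γq (λ Tq-end → bra≢end (trans (sym Tq-bra) Tq-end)))
... | U , (Rp , Rp-closed , Rp-G) , Tp≤U | V , (Rq , Rq-closed , Rq-G) , Tq≤V
  with ≤L-sel-inv Tp≤U Tp-sel | ≤L-bra-inv Tq≤V Tq-bra
... | bU , U-sel , U-cover | bV , V-bra , V-cover
  with Redex.redex-branches-agree p q U V bU bV U-sel V-bra Rp-closed Rq-closed (Rp-G , Rq-G)
... | refl with U-cover kp
... | i , ℓi≡ , Sp≤Si , Tp′≤Uᵢ with V-cover i
... | kq , ℓq≡ , Si≤Sq , Tq′≤Vᵢ with branch kq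
... | j′ , ℓj′≡ , Sq≤Sj′ , ⊢Pⱼ′ with inj j′ j (trans ℓj′≡ (trans ℓq≡ (trans ℓi≡ ℓp)))
... | refl =
  Γ′ , com-step p≢q Γp Γq Tp-sel Tq-bra kp kq ℓp (trans ℓq≡ (trans ℓi≡ ℓp)) (≤s-trans Sp≤Si Si≤Sq) ,
  unique , comm-components-typed {Γ} {Γ′} {N = N} unique typed Γ′q ⊢P′ Γ′p ⊢Q Γ′-others ,
  advance G , Balanced-advance redex balanced , WellFormed-advance redex wf ,
  Projectable-advance redex projectable ,
  Association.⊑-advance {Γ} {Γ′} Γ′p Γ′q Γ′-others Tp′≤Uᵢ Tq′≤Vᵢ redex projectable assoc
  where
  open Advance p q U V bU U-sel V-bra Rp-closed Rq-closed i
  p≢q : p ≢ q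
  p≢q p≡q = q≢p (sym p≡q)
  redex : Redex G
  redex = Rp-G , Rq-G
  Tp′ Tq′ : LTy
  Tp′ = child Tp (toℕ kp)
  Tq′ = child Tq (toℕ kq)
  Γ′ : Env
  Γ′ = Γ [ p ↦ just Tp′ ] [ q ↦ just Tq′ ]
  Γ′p : look Γ′ p ≡ just Tp′
  Γ′p = trans (look-↦-≢ (Γ [ p ↦ just Tp′ ]) q (just Tq′) p≢q) (look-↦-≡ Γ p (just Tp′))
  Γ′q : look Γ′ q ≡ just Tq′
  Γ′q = look-↦-≡ (Γ [ p ↦ just Tp′ ]) q (just Tq′)
  Γ′-others : ∀ r → r ≢ p → r ≢ q → look Γ′ r ≡ look Γ r
  Γ′-others r r≢p r≢q = trans (look-↦-≢ (Γ [ p ↦ just Tp′ ]) q (just Tq′) r≢q) (look-↦-≢ Γ p (just Tp′) r≢p)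
  ⊢P′ : ∅ ⊢ substV (Ps j) v (xs j) ∶ Tq′
  ⊢P′ = ⊢-substV (ExtendsV-∅ (xs j) (Ss j))
                 (te-sub (⊢e-↓ ⊢e e↓v) (≤s-trans S≤ (≤s-trans Sp≤Si (≤s-trans Si≤Sq Sq≤Sj′)))) ⊢Pⱼ′

⊢s-preservation : ∀ {Γ M M′ p q ℓ} → Γ ⊢s M → M —⟨ ⟨ p , q ⟩ ℓ ⟩→ M′
  → Σ Env λ Γ′ → (Γ —[ comL p q ℓ ]→ Γ′) × (Γ′ ⊢s M′)
⊢s-preservation ⊢M (r-comm {N = N} j e↓v) = comm-preserves-typing {N = N} j e↓v ⊢M
⊢s-preservation {Γ} ⊢M (r-unfold M⋙M₁ M₁→N₁ N₁⋙N) with ⊢s-preservation (⋙-preserves-⊢s {Γ} M⋙M₁ ⊢M) M₁→N₁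
... | Γ′ , Γ→Γ′ , ⊢N₁ = Γ′ , Γ→Γ′ , ⋙-preserves-⊢s {Γ′} N₁⋙N ⊢N₁

mainTheorem5 : ∀ (Γ : Env) (M M' : Session) (p q : Participant) (ℓ : Label)
    → GuardedSession M
    → Γ ⊢s M
    → M —⟨ ⟨ p , q ⟩ ℓ ⟩→ M'
    → Σ Env λ Γ' → (Γ —[ comL p q ℓ ]→ Γ') × (Γ' ⊢s M')
mainTheorem5 Γ M M' p q ℓ _ ⊢M M→M' = ⊢s-preservation ⊢M M→M'
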